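{- For every positive integer $n$, the Kirchhoff index of the prism graph $Y_n$ is $$Kf(Y_n)=\frac{n(n^2-1)}{6}+\frac{n^2}{\sqrt{3}}\left[\frac{2}{1-(2-\sqrt{3})^{n}}-1\right].$$
   Context: For $n\ge 3$, the prism graph $Y_n$ is the graph with $2n$ vertices $p_1,\dots,p_n,q_1,\dots,q_n$ and $3n$ edges: the cycle edges $p_jp_{j+1}$ and $q_jq_{j+1}$ (indices mod $n$) and the rungs $p_jq_j$; equivalently $Y_n=P_2\,\Box\, C_n$ (Cartesian product of the path on two vertices with the $n$-cycle). For $n=1,2$ the same Cartesian-product description is used with $C_2$ being two vertices joined by two parallel edges and $C_1$ being one vertex with a loop (so $Y_2$ is a 4-cycle $p_1p_2q_2q_1$ with the edges $p_1p_2$ and $q_1q_2$ doubled, and $Y_1$ is two vertices joined by one edge with a loop at each vertex). Every edge has resistance (length) $1$, and $Y_n$ is regarded as an electrical network; $r(p,q)$ denotes the effective resistance between vertices $p,q$. The Kirchhoff index is $Kf(G)=\frac12\sum_{p,q\in V(G)} r(p,q)$, i.e. the sum of effective resistances over unordered pairs of vertices. -}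

module Defs where

open import Data.Bool.Base using (Bool; true; false)
open import Data.Bool.Properties using () renaming (_≟_ to _≟B_)
open import Data.Fin.Base using (Fin; toℕ)
open import Data.Fin.Properties using () renaming (_≟_ to _≟F_)
open import Data.List.Base using (List; []; _∷_; foldr; concatMap; allFin; map)
open import Data.Nat.Base as ℕ using (ℕ; NonZero)
import Data.Integer.Base as ℤ
open import Data.Nat.DivMod using (_mod_)
open import Data.Product.Base using (Σ; _×_; _,_; proj₁; proj₂)
open import Data.Rational.Base as ℚ using (ℚ; 0ℚ; 1ℚ; _+_; _*_; _-_; -_; 1/_; ≢-nonZero)
open import Data.Rational.Properties using () renaming (_≟_ to _≟Q_)
open import Relation.Binary.PropositionalEquality using (_≡_)
open import Relation.Nullary using (yes; no; Dec)

-- The prism graph Y_n  (n ≥ 1), as a multigraph given by its edge list.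
-- Vertex (false , j) is p_j, vertex (true , j) is q_j  (j = 0 … n-1).

Vertex : ℕ → Set
Vertex n = Bool × Fin n

_≟V_ : ∀ {n} (u v : Vertex n) → Dec (u ≡ v)
(a , i) ≟V (b , j) with a ≟B b | i ≟F j
... | yes Relation.Binary.PropositionalEquality.refl | yes Relation.Binary.PropositionalEquality.refl = yes Relation.Binary.PropositionalEquality.refl
... | no ¬p | _ = no (λ { Relation.Binary.PropositionalEquality.refl → ¬p Relation.Binary.PropositionalEquality.refl })
... | yes _ | no ¬q = no (λ { Relation.Binary.PropositionalEquality.refl → ¬q Relation.Binary.PropositionalEquality.refl })

next : ∀ n .{{_ : NonZero n}} → Fin n → Fin n
next n j = (ℕ.suc (toℕ j)) mod n

p q : ∀ {n} → Fin n → Vertex n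
p j = (false , j)
q j = (true , j)

-- Edge multiset of Y_n (each listed edge has resistance 1):
-- p_j p_{j+1}, q_j q_{j+1}, p_j q_j for j = 0 … n-1.
-- For n = 2 this yields the doubled edges p_1p_2, q_1q_2; for n = 1 the
-- cycle edges are loops, exactly as in the paper's convention.
edges : ∀ n .{{_ : NonZero n}} → List (Vertex n × Vertex n)
edges n = concatMap
  (λ j → (p j , p (next n j)) ∷ (q j , q (next n j)) ∷ (p j , q j) ∷ [])
  (allFin n)

ℕtoℚ : ℕ → ℚ
ℕtoℚ m = (ℤ.+ m) ℚ./ 1

sumList : List ℚ → ℚ
sumList = foldr _+_ 0ℚ

δ : ∀ {n} → Vertex n → Vertex n → ℚ
δ u v with u ≟V v
... | yes _ = 1ℚ
... | no _ = 0ℚ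

-- Net current flowing out of vertex v for the potential x
-- (current x_a - x_b flows from a to b along each edge ab of resistance 1).
outflow : ∀ n .{{_ : NonZero n}} → (Vertex n → ℚ) → Vertex n → ℚ
outflow n x v = sumList (map
  (λ e → δ v (proj₁ e) * (x (proj₁ e) - x (proj₂ e))
        + δ v (proj₂ e) * (x (proj₂ e) - x (proj₁ e)))
  (edges n))

-- r is the effective resistance between a and b in Y_n: there is a
-- potential x realising a unit current injected at a and extracted at b
-- (Kirchhoff's laws), and r is the resulting potential difference.
IsEffRes : ∀ n .{{_ : NonZero n}} → Vertex n → Vertex n → ℚ → Set
IsEffRes n a b r =
  Σ (Vertex n → ℚ) λ x →
    ((v : Vertex n) → outflow n x v ≡ δ v a - δ v b) × (r ≡ x a - x b)

allVertices : ∀ n → List (Vertex n)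
allVertices n = map (λ j → (false , j)) (allFin n) Data.List.Base.++ map (λ j → (true , j)) (allFin n)

kirchhoff : ∀ n → (Vertex n → Vertex n → ℚ) → ℚ
kirchhoff n R = (ℚ.½) * sumList (concatMap (λ a → map (λ b → R a b) (allVertices n)) (allVertices n))

-- The field ℚ(√3): a + b√3 represented as ⟨ a , b ⟩.

record ℚ√3 : Set where
  constructor ⟨_,_⟩
  field
    re : ℚ
    im : ℚ
open ℚ√3 public

infixl 6 _⊕_ _⊖_
infixl 7 _⊗_

_⊕_ : ℚ√3 → ℚ√3 → ℚ√3
⟨ a , b ⟩ ⊕ ⟨ c , d ⟩ = ⟨ a + c , b + d ⟩

_⊖_ : ℚ√3 → ℚ√3 → ℚ√3
⟨ a , b ⟩ ⊖ ⟨ c , d ⟩ = ⟨ a - c , b - d ⟩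

_⊗_ : ℚ√3 → ℚ√3 → ℚ√3
⟨ a , b ⟩ ⊗ ⟨ c , d ⟩ = ⟨ a * c + ℕtoℚ 3 * (b * d) , a * d + b * c ⟩

-- total reciprocal on ℚ (1/0 := 0; never used at 0 in the statement)
inv : ℚ → ℚ
inv r with r ≟Q 0ℚ
... | yes _ = 0ℚ
... | no r≢0 = (1/ r) {{≢-nonZero r≢0}}

-- multiplicative inverse in ℚ(√3): (a + b√3)⁻¹ = (a - b√3)/(a² - 3b²)
-- (the norm a² - 3b² vanishes only at 0 since √3 is irrational; 0⁻¹ := 0)
recip : ℚ√3 → ℚ√3
recip ⟨ a , b ⟩ = ⟨ a * N⁻¹ , (- b) * N⁻¹ ⟩
  where N⁻¹ = inv (a * a - ℕtoℚ 3 * (b * b))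

embed : ℚ → ℚ√3
embed r = ⟨ r , 0ℚ ⟩

√3 : ℚ√3
√3 = ⟨ 0ℚ , 1ℚ ⟩

_^_ : ℚ√3 → ℕ → ℚ√3
x ^ ℕ.zero = embed 1ℚ
x ^ ℕ.suc k = x ⊗ (x ^ k)

rhs : ℕ → ℚ√3
rhs n = embed (ℕtoℚ (n ℕ.* (n ℕ.* n ℕ.∸ 1)) * inv (ℕtoℚ 6))
      ⊕ embed (ℕtoℚ (n ℕ.* n)) ⊗ recip √3
          ⊗ (embed (ℕtoℚ 2) ⊗ recip (embed 1ℚ ⊖ (embed (ℕtoℚ 2) ⊖ √3) ^ n)
             ⊖ embed 1ℚ)

module Submission where

-- Effective resistances of Y_n are differences of a Green's function. Taking the sum and the
-- difference of a potential over the two n-cycles decouples the Laplacian: the sum S solves the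
-- Poisson equation ΔS = δ₀ - 1/n on C_n, solved by the parabola S k = -k(n-k)/(2n), and the
-- difference D solves (Δ + 2) D = δ₀, solved by D k ∝ W k + W (n-k), where
-- (2 - √3)^k = U k - W k √3, so that W (k+2) = 4 W (k+1) - W k. Reciprocity (symmetry of the
-- Laplacian form) makes the resistance independent of the potential realising it. The Green's
-- function has constant diagonal and constant row sums, which turns the Kirchhoff index into
-- Σ k(n-k) + n² W n / (U n - 1); and for x = (2 - √3)^n, of norm U² - 3W² = 1,
-- 2/(1 - x) - 1 = √3 W n / (U n - 1), which gives the stated formula.

open import Defs
open import Data.Bool.Base using (Bool; true; false; not; _xor_)
open import Data.Bool.Properties using (not-distribˡ-xor; xor-same)
open import Data.Empty using (⊥-elim)
open import Data.Fin.Base as Fin using (Fin; toℕ)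
import Data.Fin.Properties as Finₚ
import Data.Integer.Base as ℤ
import Data.Integer.Properties as ℤₚ
open import Data.List.Base using (List; []; _∷_; map; concatMap; tabulate; allFin; length; _++_)
import Data.List.Properties as Listₚ
open import Data.Maybe.Base using (Maybe; just; nothing)
open import Data.Nat.Base as ℕ using (ℕ; NonZero; zero; suc; _∸_; _%_; _≤_; _<_)
open import Data.Nat.DivMod using (_mod_; m%n<n; %-distribˡ-+; m%n%n≡m%n; [m+n]%n≡m%n; m<n⇒m%n≡m; n%n≡0)
import Data.Nat.Properties as ℕₚ
import Data.Nat.Tactic.RingSolver as ℕ-Solver
open import Data.Product.Base using (Σ; _×_; _,_; proj₁; proj₂)
open import Data.Rational.Base as ℚ using (ℚ; 0ℚ; 1ℚ; ½; _+_; _*_; _-_; -_; toℚᵘ)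
import Data.Rational.Properties as ℚₚ
open import Data.Rational.Unnormalised.Base as ℚᵘ using (mkℚᵘ; *≡*)
import Data.Rational.Unnormalised.Properties as ℚᵘₚ
open import Data.Sum.Base using (inj₁; inj₂)
open import Function.Base using (_∘_)
open import Level using (0ℓ)
open import Relation.Binary.PropositionalEquality
  using (_≡_; refl; sym; trans; cong; cong₂; _≢_; _≗_; module ≡-Reasoning)
open import Relation.Nullary using (yes; no)
import Tactic.RingSolver.Core.AlmostCommutativeRing as ACR
open import Tactic.RingSolver using (solve-∀)

ℚ-ring : ACR.AlmostCommutativeRing 0ℓ 0ℓ
ℚ-ring = ACR.fromCommutativeRing ℚₚ.+-*-commutativeRing 0≟
  where
  0≟ : ∀ x → Maybe (0ℚ ≡ x)
  0≟ x with 0ℚ ℚₚ.≟ x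
  ... | yes 0≡x = just 0≡x
  ... | no _ = nothing

toℚᵘ-ℕtoℚ : ∀ m → toℚᵘ (ℕtoℚ m) ℚᵘ.≃ mkℚᵘ (ℤ.+ m) 0
toℚᵘ-ℕtoℚ m = ℚₚ.toℚᵘ-fromℚᵘ (mkℚᵘ (ℤ.+ m) 0)

ℕtoℚ-+ : ∀ a b → ℕtoℚ (a ℕ.+ b) ≡ ℕtoℚ a + ℕtoℚ b
ℕtoℚ-+ a b = ℚₚ.toℚᵘ-injective (begin
  toℚᵘ (ℕtoℚ (a ℕ.+ b))               ≈⟨ toℚᵘ-ℕtoℚ (a ℕ.+ b) ⟩
  mkℚᵘ (ℤ.+ (a ℕ.+ b)) 0               ≈⟨ *≡* (cong (ℤ._* ℤ.+ 1) (trans (ℤₚ.pos-+ a b)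
                                           (sym (cong₂ ℤ._+_ (ℤₚ.*-identityʳ (ℤ.+ a)) (ℤₚ.*-identityʳ (ℤ.+ b)))))) ⟩
  mkℚᵘ (ℤ.+ a) 0 ℚᵘ.+ mkℚᵘ (ℤ.+ b) 0   ≈⟨ ℚᵘₚ.+-cong (ℚᵘₚ.≃-sym (toℚᵘ-ℕtoℚ a)) (ℚᵘₚ.≃-sym (toℚᵘ-ℕtoℚ b)) ⟩
  toℚᵘ (ℕtoℚ a) ℚᵘ.+ toℚᵘ (ℕtoℚ b)     ≈⟨ ℚᵘₚ.≃-sym (ℚₚ.toℚᵘ-homo-+ (ℕtoℚ a) (ℕtoℚ b)) ⟩
  toℚᵘ (ℕtoℚ a + ℕtoℚ b)               ∎)
  where open ℚᵘₚ.≃-Reasoning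

ℕtoℚ-* : ∀ a b → ℕtoℚ (a ℕ.* b) ≡ ℕtoℚ a * ℕtoℚ b
ℕtoℚ-* a b = ℚₚ.toℚᵘ-injective (begin
  toℚᵘ (ℕtoℚ (a ℕ.* b))               ≈⟨ toℚᵘ-ℕtoℚ (a ℕ.* b) ⟩
  mkℚᵘ (ℤ.+ (a ℕ.* b)) 0               ≈⟨ *≡* (cong (ℤ._* ℤ.+ 1) (ℤₚ.pos-* a b)) ⟩
  mkℚᵘ (ℤ.+ a) 0 ℚᵘ.* mkℚᵘ (ℤ.+ b) 0   ≈⟨ ℚᵘₚ.*-cong (ℚᵘₚ.≃-sym (toℚᵘ-ℕtoℚ a)) (ℚᵘₚ.≃-sym (toℚᵘ-ℕtoℚ b)) ⟩
  toℚᵘ (ℕtoℚ a) ℚᵘ.* toℚᵘ (ℕtoℚ b)     ≈⟨ ℚᵘₚ.≃-sym (ℚₚ.toℚᵘ-homo-* (ℕtoℚ a) (ℕtoℚ b)) ⟩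
  toℚᵘ (ℕtoℚ a * ℕtoℚ b)               ∎)
  where open ℚᵘₚ.≃-Reasoning

ℕtoℚ-suc : ∀ m → ℕtoℚ (suc m) ≡ 1ℚ + ℕtoℚ m
ℕtoℚ-suc m = ℕtoℚ-+ 1 m

ℕtoℚ-injective : ∀ {a b} → ℕtoℚ a ≡ ℕtoℚ b → a ≡ b
ℕtoℚ-injective {a} {b} eq with ℚᵘₚ.≃-trans (ℚᵘₚ.≃-sym (toℚᵘ-ℕtoℚ a))
                                 (ℚᵘₚ.≃-trans (ℚᵘₚ.≃-reflexive (cong toℚᵘ eq)) (toℚᵘ-ℕtoℚ b))
... | *≡* e = ℤₚ.+-injective (trans (sym (ℤₚ.*-identityʳ (ℤ.+ a))) (trans e (ℤₚ.*-identityʳ (ℤ.+ b))))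

ℕtoℚ-suc≢0 : ∀ m → ℕtoℚ (suc m) ≢ 0ℚ
ℕtoℚ-suc≢0 m eq with ℕtoℚ-injective {suc m} {0} eq
... | ()

*-inv : ∀ {r} → r ≢ 0ℚ → r * inv r ≡ 1ℚ
*-inv {r} r≢0 with r ℚₚ.≟ 0ℚ
... | yes r≡0 = ⊥-elim (r≢0 r≡0)
... | no r≢0′ = ℚₚ.*-inverseʳ r {{ℚ.≢-nonZero r≢0′}}

inv-unique : ∀ r {s} → r * s ≡ 1ℚ → inv r ≡ s
inv-unique r {s} rs≡1 = begin
  inv r             ≡⟨ ℚₚ.*-identityʳ (inv r) ⟨
  inv r * 1ℚ        ≡⟨ cong (inv r *_) rs≡1 ⟨
  inv r * (r * s)   ≡⟨ ℚₚ.*-assoc (inv r) r s ⟨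
  inv r * r * s     ≡⟨ cong (_* s) (trans (ℚₚ.*-comm (inv r) r) (*-inv r≢0)) ⟩
  1ℚ * s            ≡⟨ ℚₚ.*-identityˡ s ⟩
  s                 ∎
  where
  open ≡-Reasoning
  r≢0 : r ≢ 0ℚ
  r≢0 refl = ℚₚ.1≢0 (trans (sym rs≡1) (ℚₚ.*-zeroˡ s))

private
  variable
    A B : Set

sumList-++ : ∀ (xs ys : List ℚ) → sumList (xs ++ ys) ≡ sumList xs + sumList ys
sumList-++ []       ys = sym (ℚₚ.+-identityˡ (sumList ys))
sumList-++ (x ∷ xs) ys = trans (cong (x +_) (sumList-++ xs ys)) (sym (ℚₚ.+-assoc x (sumList xs) (sumList ys)))

sumList-concatMap : ∀ (h : A → List ℚ) (xs : List A) →
                    sumList (concatMap h xs) ≡ sumList (map (sumList ∘ h) xs)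
sumList-concatMap h []       = refl
sumList-concatMap h (x ∷ xs) = trans (sumList-++ (h x) (concatMap h xs)) (cong (sumList (h x) +_) (sumList-concatMap h xs))

sumList-cong : ∀ {f g : A → ℚ} → f ≗ g → ∀ xs → sumList (map f xs) ≡ sumList (map g xs)
sumList-cong f≗g xs = cong sumList (Listₚ.map-cong f≗g xs)

sumList-+ : ∀ (f g : A → ℚ) xs → sumList (map (λ x → f x + g x) xs) ≡ sumList (map f xs) + sumList (map g xs)
sumList-+ f g []       = refl
sumList-+ f g (x ∷ xs) = trans (cong (f x + g x +_) (sumList-+ f g xs)) (interchange (f x) (g x) _ _)
  where
  interchange : ∀ a b c d → (a + b) + (c + d) ≡ (a + c) + (b + d)
  interchange = solve-∀ ℚ-ring

sumList-*ˡ : ∀ c (f : A → ℚ) xs → c * sumList (map f xs) ≡ sumList (map (λ x → c * f x) xs)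
sumList-*ˡ c f []       = ℚₚ.*-zeroʳ c
sumList-*ˡ c f (x ∷ xs) = trans (ℚₚ.*-distribˡ-+ c (f x) (sumList (map f xs))) (cong (c * f x +_) (sumList-*ˡ c f xs))

sumList-const : ∀ c (xs : List A) → sumList (map (λ _ → c) xs) ≡ ℕtoℚ (length xs) * c
sumList-const c []       = sym (ℚₚ.*-zeroˡ c)
sumList-const c (x ∷ xs) = begin
  c + sumList (map (λ _ → c) xs)  ≡⟨ cong (c +_) (sumList-const c xs) ⟩
  c + ℕtoℚ (length xs) * c        ≡⟨ factor c (ℕtoℚ (length xs)) ⟩
  (1ℚ + ℕtoℚ (length xs)) * c     ≡⟨ cong (_* c) (ℕtoℚ-suc (length xs)) ⟨
  ℕtoℚ (suc (length xs)) * c      ∎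
  where
  open ≡-Reasoning
  factor : ∀ c l → c + l * c ≡ (1ℚ + l) * c
  factor = solve-∀ ℚ-ring

sumList-swap : ∀ (F : A → B → ℚ) (xs : List A) (ys : List B) →
  sumList (map (λ x → sumList (map (F x) ys)) xs) ≡ sumList (map (λ y → sumList (map (λ x → F x y) xs)) ys)
sumList-swap F []       ys = sym (trans (sumList-const 0ℚ ys) (ℚₚ.*-zeroʳ (ℕtoℚ (length ys))))
sumList-swap F (x ∷ xs) ys = trans (cong (sumList (map (F x) ys) +_) (sumList-swap F xs ys))
  (sym (sumList-+ (F x) (λ y → sumList (map (λ x → F x y) xs)) ys))

sumList-- : ∀ (f g : A → ℚ) xs → sumList (map (λ x → f x - g x) xs) ≡ sumList (map f xs) - sumList (map g xs)
sumList-- f g []       = refl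
sumList-- f g (x ∷ xs) = trans (cong (f x - g x +_) (sumList-- f g xs)) (interchange (f x) (g x) _ _)
  where
  interchange : ∀ a b c d → (a - b) + (c - d) ≡ (a + c) - (b + d)
  interchange = solve-∀ ℚ-ring

sumList-kirchhoff : ∀ (xs : List A) (G : A → A → ℚ) g₀ T →
  (∀ a → G a a ≡ g₀) → (∀ a → sumList (map (G a) xs) ≡ T) →
  let m = ℕtoℚ (length xs) in
  sumList (concatMap (λ a → map (λ b → (G a a - G b a) - (G a b - G b b)) xs) xs)
    ≡ m * (m * (g₀ + g₀)) - (m * T + m * T)
sumList-kirchhoff xs G g₀ T diag row = begin
  sumList (concatMap (λ a → map (λ b → (G a a - G b a) - (G a b - G b b)) xs) xs)
    ≡⟨ sumList-concatMap _ xs ⟩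
  sumList (map (λ a → sumList (map (λ b → (G a a - G b a) - (G a b - G b b)) xs)) xs)
    ≡⟨ sumList-cong inner xs ⟩
  sumList (map (λ a → m * (g₀ + g₀) - (T + sumList (map (λ b → G b a) xs))) xs)
    ≡⟨ sumList-- (λ _ → m * (g₀ + g₀)) (λ a → T + sumList (map (λ b → G b a) xs)) xs ⟩
  sumList (map (λ _ → m * (g₀ + g₀)) xs) - sumList (map (λ a → T + sumList (map (λ b → G b a) xs)) xs)
    ≡⟨ cong₂ _-_ (sumList-const _ xs) (sumList-+ (λ _ → T) (λ a → sumList (map (λ b → G b a) xs)) xs) ⟩
  m * (m * (g₀ + g₀)) - (sumList (map (λ _ → T) xs) + sumList (map (λ a → sumList (map (λ b → G b a) xs)) xs))
    ≡⟨ cong (λ t → m * (m * (g₀ + g₀)) - (sumList (map (λ _ → T) xs) + t)) (sumList-swap (λ a b → G b a) xs xs) ⟩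
  m * (m * (g₀ + g₀)) - (sumList (map (λ _ → T) xs) + sumList (map (λ b → sumList (map (G b) xs)) xs))
    ≡⟨ cong (λ t → m * (m * (g₀ + g₀)) - (sumList (map (λ _ → T) xs) + t)) (sumList-cong row xs) ⟩
  m * (m * (g₀ + g₀)) - (sumList (map (λ _ → T) xs) + sumList (map (λ _ → T) xs))
    ≡⟨ cong (λ t → m * (m * (g₀ + g₀)) - (t + t)) (sumList-const T xs) ⟩
  m * (m * (g₀ + g₀)) - (m * T + m * T) ∎
  where
  open ≡-Reasoning
  m : ℚ
  m = ℕtoℚ (length xs)
  rearrange : ∀ gaa gbb gab gba → (gaa - gba) - (gab - gbb) ≡ (gaa + gbb) - (gab + gba)
  rearrange = solve-∀ ℚ-ring
  inner : ∀ a → sumList (map (λ b → (G a a - G b a) - (G a b - G b b)) xs)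
              ≡ m * (g₀ + g₀) - (T + sumList (map (λ b → G b a) xs))
  inner a = begin
    sumList (map (λ b → (G a a - G b a) - (G a b - G b b)) xs)
      ≡⟨ sumList-cong (λ b → trans (rearrange (G a a) (G b b) (G a b) (G b a)) (cong₂ (λ x y → (x + y) - (G a b + G b a)) (diag a) (diag b))) xs ⟩
    sumList (map (λ b → (g₀ + g₀) - (G a b + G b a)) xs)
      ≡⟨ sumList-- (λ _ → g₀ + g₀) (λ b → G a b + G b a) xs ⟩
    sumList (map (λ _ → g₀ + g₀) xs) - sumList (map (λ b → G a b + G b a) xs)
      ≡⟨ cong₂ _-_ (sumList-const _ xs) (trans (sumList-+ (G a) (λ b → G b a) xs) (cong (_+ sumList (map (λ b → G b a) xs)) (row a))) ⟩
    m * (g₀ + g₀) - (T + sumList (map (λ b → G b a) xs)) ∎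

sumFin : ∀ {n} → (Fin n → ℚ) → ℚ
sumFin f = sumList (tabulate f)

sumList-allFin : ∀ {n} (f : Fin n → ℚ) → sumList (map f (allFin n)) ≡ sumFin f
sumList-allFin {n} f = cong sumList (Listₚ.map-tabulate {n = n} (λ j → j) f)

sumFin-+ : ∀ {n} (f g : Fin n → ℚ) → sumFin (λ j → f j + g j) ≡ sumFin f + sumFin g
sumFin-+ {n} f g = begin
  sumFin (λ j → f j + g j)                                    ≡⟨ sumList-allFin (λ j → f j + g j) ⟨
  sumList (map (λ j → f j + g j) (allFin n))                  ≡⟨ sumList-+ f g (allFin n) ⟩
  sumList (map f (allFin n)) + sumList (map g (allFin n))     ≡⟨ cong₂ _+_ (sumList-allFin f) (sumList-allFin g) ⟩
  sumFin f + sumFin g                                         ∎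
  where open ≡-Reasoning

sumFin-zero : ∀ {n} (f : Fin n → ℚ) → (∀ j → f j ≡ 0ℚ) → sumFin f ≡ 0ℚ
sumFin-zero {zero}  f f≡0 = refl
sumFin-zero {suc n} f f≡0 = cong₂ _+_ (f≡0 Fin.zero) (sumFin-zero (f ∘ Fin.suc) (f≡0 ∘ Fin.suc))

sumFin-single : ∀ {n} (f : Fin n → ℚ) i → (∀ j → j ≢ i → f j ≡ 0ℚ) → sumFin f ≡ f i
sumFin-single {suc n} f Fin.zero f≡0 =
  trans (cong (f Fin.zero +_) (sumFin-zero (f ∘ Fin.suc) (λ j → f≡0 (Fin.suc j) λ ())))
        (ℚₚ.+-identityʳ (f Fin.zero))
sumFin-single {suc n} f (Fin.suc i) f≡0 =
  trans (cong₂ _+_ (f≡0 Fin.zero λ ()) (sumFin-single (f ∘ Fin.suc) i (λ j j≢i → f≡0 (Fin.suc j) (j≢i ∘ Finₚ.suc-injective))))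
        (ℚₚ.+-identityˡ (f (Fin.suc i)))

sumRange : ℕ → (ℕ → ℚ) → ℚ
sumRange zero    f = 0ℚ
sumRange (suc m) f = sumRange m f + f m

sumRange-cons : ∀ m f → sumRange (suc m) f ≡ f 0 + sumRange m (f ∘ suc)
sumRange-cons zero    f = ℚₚ.+-comm 0ℚ (f 0)
sumRange-cons (suc m) f = trans (cong (_+ f (suc m)) (sumRange-cons m f)) (ℚₚ.+-assoc (f 0) (sumRange m (f ∘ suc)) (f (suc m)))

sumFin-toℕ : ∀ m (f : ℕ → ℚ) → sumFin (λ (j : Fin m) → f (toℕ j)) ≡ sumRange m f
sumFin-toℕ zero    f = refl
sumFin-toℕ (suc m) f = trans (cong (f 0 +_) (sumFin-toℕ m (f ∘ suc))) (sym (sumRange-cons m f))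

sumRange-cong : ∀ m {f g : ℕ → ℚ} → (∀ k → k < m → f k ≡ g k) → sumRange m f ≡ sumRange m g
sumRange-cong zero    f≡g = refl
sumRange-cong (suc m) f≡g = cong₂ _+_ (sumRange-cong m (λ k k<m → f≡g k (ℕₚ.m<n⇒m<1+n k<m))) (f≡g m ℕₚ.≤-refl)

sumRange-+ : ∀ m (f g : ℕ → ℚ) → sumRange m (λ k → f k + g k) ≡ sumRange m f + sumRange m g
sumRange-+ zero    f g = refl
sumRange-+ (suc m) f g = trans (cong (_+ (f m + g m)) (sumRange-+ m f g)) (interchange (sumRange m f) (sumRange m g) (f m) (g m))
  where
  interchange : ∀ a b c d → (a + b) + (c + d) ≡ (a + c) + (b + d)
  interchange = solve-∀ ℚ-ring

sumRange-telescope : ∀ m (f F : ℕ → ℚ) → (∀ k → f k ≡ F (suc k) - F k) → sumRange m f ≡ F m - F 0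
sumRange-telescope zero    f F step = sym (ℚₚ.+-inverseʳ (F 0))
sumRange-telescope (suc m) f F step =
  trans (cong₂ _+_ (sumRange-telescope m f F step) (step m)) (collapse (F 0) (F m) (F (suc m)))
  where
  collapse : ∀ a b c → (b - a) + (c - b) ≡ c - a
  collapse = solve-∀ ℚ-ring

δ-self : ∀ {n} (u : Vertex n) → δ u u ≡ 1ℚ
δ-self u with u ≟V u
... | yes _  = refl
... | no u≢u = ⊥-elim (u≢u refl)

δ-distinct : ∀ {n} {u v : Vertex n} → u ≢ v → δ u v ≡ 0ℚ
δ-distinct {u = u} {v} u≢v with u ≟V v
... | yes u≡v = ⊥-elim (u≢v u≡v)
... | no _    = refl

vertex : ∀ {n} → Bool → Fin n → Vertex n
vertex s j = (s , j)

length-allVertices : ∀ n → length (allVertices n) ≡ n ℕ.+ n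
length-allVertices n = trans (Listₚ.length-++ (map (vertex false) (allFin n)))
  (cong₂ ℕ._+_ (trans (Listₚ.length-map (vertex false) (allFin n)) (Listₚ.length-tabulate {n = n} (λ j → j)))
               (trans (Listₚ.length-map (vertex true) (allFin n)) (Listₚ.length-tabulate {n = n} (λ j → j))))

sumList-allVertices : ∀ {n} (f : Vertex n → ℚ) →
  sumList (map f (allVertices n)) ≡ sumFin (λ j → f (false , j)) + sumFin (λ j → f (true , j))
sumList-allVertices {n} f = begin
  sumList (map f (map (vertex false) (allFin n) ++ map (vertex true) (allFin n)))
    ≡⟨ cong sumList (Listₚ.map-++ f (map (vertex false) (allFin n)) (map (vertex true) (allFin n))) ⟩
  sumList (map f (map (vertex false) (allFin n)) ++ map f (map (vertex true) (allFin n)))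
    ≡⟨ sumList-++ (map f (map (vertex false) (allFin n))) (map f (map (vertex true) (allFin n))) ⟩
  sumList (map f (map (vertex false) (allFin n))) + sumList (map f (map (vertex true) (allFin n)))
    ≡⟨ cong₂ _+_ (layer false) (layer true) ⟩
  sumFin (λ j → f (false , j)) + sumFin (λ j → f (true , j)) ∎
  where
  open ≡-Reasoning
  layer : ∀ s → sumList (map f (map (vertex s) (allFin n))) ≡ sumFin (λ j → f (s , j))
  layer s = trans (cong sumList (sym (Listₚ.map-∘ (allFin n)))) (sumList-allFin (λ j → f (s , j)))

sumList-allVertices-single : ∀ {n} (f : Vertex n → ℚ) w → (∀ v → v ≢ w → f v ≡ 0ℚ) →
                             sumList (map f (allVertices n)) ≡ f w
sumList-allVertices-single f (false , i) f≡0 = trans (sumList-allVertices f) (trans (cong₂ _+_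
    (sumFin-single (λ j → f (false , j)) i (λ j j≢i → f≡0 (false , j) (j≢i ∘ cong proj₂)))
    (sumFin-zero (λ j → f (true , j)) (λ j → f≡0 (true , j) λ ())))
  (ℚₚ.+-identityʳ (f (false , i))))
sumList-allVertices-single f (true , i) f≡0 = trans (sumList-allVertices f) (trans (cong₂ _+_
    (sumFin-zero (λ j → f (false , j)) (λ j → f≡0 (false , j) λ ()))
    (sumFin-single (λ j → f (true , j)) i (λ j j≢i → f≡0 (true , j) (j≢i ∘ cong proj₂))))
  (ℚₚ.+-identityˡ (f (true , i))))

sumList-allVertices-δ : ∀ {n} (f : Vertex n → ℚ) w → sumList (map (λ v → f v * δ v w) (allVertices n)) ≡ f w
sumList-allVertices-δ f w = trans
  (sumList-allVertices-single (λ v → f v * δ v w) w (λ v v≢w → trans (cong (f v *_) (δ-distinct v≢w)) (ℚₚ.*-zeroʳ (f v))))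
  (trans (cong (f w *_) (δ-self w)) (ℚₚ.*-identityʳ (f w)))

edgeOutflow : ∀ {n} → (Vertex n → ℚ) → Vertex n → Vertex n × Vertex n → ℚ
edgeOutflow x v e = δ v (proj₁ e) * (x (proj₁ e) - x (proj₂ e)) + δ v (proj₂ e) * (x (proj₂ e) - x (proj₁ e))

sumFin-δ-hit : ∀ {n m} v (f : Fin m → Vertex n) (y : Fin m → ℚ) j₀ → f j₀ ≡ v → (∀ j → f j ≡ v → j ≡ j₀) →
               sumFin (λ j → δ v (f j) * y j) ≡ y j₀
sumFin-δ-hit v f y j₀ fj₀≡v hit-unique = trans
  (sumFin-single (λ j → δ v (f j) * y j) j₀
    (λ j j≢j₀ → trans (cong (_* y j) (δ-distinct (λ v≡fj → j≢j₀ (hit-unique j (sym v≡fj))))) (ℚₚ.*-zeroˡ (y j))))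
  (trans (cong (λ u → δ v u * y j₀) fj₀≡v) (trans (cong (_* y j₀) (δ-self v)) (ℚₚ.*-identityˡ (y j₀))))

sumFin-δ-miss : ∀ {n m} v (f : Fin m → Vertex n) (y : Fin m → ℚ) → (∀ j → f j ≢ v) →
                sumFin (λ j → δ v (f j) * y j) ≡ 0ℚ
sumFin-δ-miss v f y miss = sumFin-zero (λ j → δ v (f j) * y j)
  (λ j → trans (cong (_* y j) (δ-distinct (miss j ∘ sym))) (ℚₚ.*-zeroˡ (y j)))

module _ (n : ℕ) .{{_ : NonZero n}} where

  laplacianForm : (Vertex n → ℚ) → (Vertex n → ℚ) → ℚ
  laplacianForm x z = sumList (map (λ v → x v * outflow n z v) (allVertices n))

  edgeEnergy : (Vertex n → ℚ) → (Vertex n → ℚ) → Vertex n × Vertex n → ℚ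
  edgeEnergy x z (a , b) = x a * (z a - z b) + x b * (z b - z a)

  laplacianForm-edges : ∀ x z → laplacianForm x z ≡ sumList (map (edgeEnergy x z) (edges n))
  laplacianForm-edges x z = begin
    sumList (map (λ v → x v * outflow n z v) V)
      ≡⟨ sumList-cong (λ v → sumList-*ˡ (x v) (edgeOutflow z v) (edges n)) V ⟩
    sumList (map (λ v → sumList (map (λ e → x v * edgeOutflow z v e) (edges n))) V)
      ≡⟨ sumList-swap (λ v e → x v * edgeOutflow z v e) V (edges n) ⟩
    sumList (map (λ e → sumList (map (λ v → x v * edgeOutflow z v e) V)) (edges n))
      ≡⟨ sumList-cong edge (edges n) ⟩
    sumList (map (edgeEnergy x z) (edges n)) ∎
    where
    open ≡-Reasoning
    V : List (Vertex n)
    V = allVertices n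
    spread : ∀ x d₁ c₁ d₂ c₂ → x * (d₁ * c₁ + d₂ * c₂) ≡ (x * c₁) * d₁ + (x * c₂) * d₂
    spread = solve-∀ ℚ-ring
    edge : ∀ e → sumList (map (λ v → x v * edgeOutflow z v e) V) ≡ edgeEnergy x z e
    edge (a , b) = begin
      sumList (map (λ v → x v * edgeOutflow z v (a , b)) V)
        ≡⟨ sumList-cong (λ v → spread (x v) (δ v a) (z a - z b) (δ v b) (z b - z a)) V ⟩
      sumList (map (λ v → (x v * (z a - z b)) * δ v a + (x v * (z b - z a)) * δ v b) V)
        ≡⟨ sumList-+ (λ v → (x v * (z a - z b)) * δ v a) (λ v → (x v * (z b - z a)) * δ v b) V ⟩
      _ ≡⟨ cong₂ _+_ (sumList-allVertices-δ (λ v → x v * (z a - z b)) a) (sumList-allVertices-δ (λ v → x v * (z b - z a)) b) ⟩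
      edgeEnergy x z (a , b) ∎

  laplacianForm-sym : ∀ x z → laplacianForm x z ≡ laplacianForm z x
  laplacianForm-sym x z = begin
    laplacianForm x z                          ≡⟨ laplacianForm-edges x z ⟩
    sumList (map (edgeEnergy x z) (edges n))   ≡⟨ sumList-cong (λ e → swap (x (proj₁ e)) (x (proj₂ e)) (z (proj₁ e)) (z (proj₂ e))) (edges n) ⟩
    sumList (map (edgeEnergy z x) (edges n))   ≡⟨ laplacianForm-edges z x ⟨
    laplacianForm z x                          ∎
    where
    open ≡-Reasoning
    swap : ∀ xa xb za zb → xa * (za - zb) + xb * (zb - za) ≡ za * (xa - xb) + zb * (xb - xa)
    swap = solve-∀ ℚ-ring

  sumList-dipole : ∀ (x : Vertex n → ℚ) a b → sumList (map (λ v → x v * (δ v a - δ v b)) (allVertices n)) ≡ x a - x b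
  sumList-dipole x a b = begin
    sumList (map (λ v → x v * (δ v a - δ v b)) (allVertices n))
      ≡⟨ sumList-cong (λ v → split (x v) (δ v a) (δ v b)) (allVertices n) ⟩
    sumList (map (λ v → x v * δ v a - x v * δ v b) (allVertices n))
      ≡⟨ sumList-- (λ v → x v * δ v a) (λ v → x v * δ v b) (allVertices n) ⟩
    _ ≡⟨ cong₂ _-_ (sumList-allVertices-δ x a) (sumList-allVertices-δ x b) ⟩
    x a - x b ∎
    where
    open ≡-Reasoning
    split : ∀ x d₁ d₂ → x * (d₁ - d₂) ≡ x * d₁ - x * d₂
    split = solve-∀ ℚ-ring

  effRes-unique : ∀ {a b r} → IsEffRes n a b r → (z : Vertex n → ℚ) →
                  (∀ v → outflow n z v ≡ δ v a - δ v b) → r ≡ z a - z b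
  effRes-unique {a} {b} {r} (x , x-flow , r≡) z z-flow = begin
    r                                                            ≡⟨ r≡ ⟩
    x a - x b                                                    ≡⟨ sumList-dipole x a b ⟨
    sumList (map (λ v → x v * (δ v a - δ v b)) (allVertices n))  ≡⟨ sumList-cong (λ v → cong (x v *_) (z-flow v)) (allVertices n) ⟨
    laplacianForm x z                                            ≡⟨ laplacianForm-sym x z ⟩
    laplacianForm z x                                            ≡⟨ sumList-cong (λ v → cong (z v *_) (x-flow v)) (allVertices n) ⟩
    sumList (map (λ v → z v * (δ v a - δ v b)) (allVertices n))  ≡⟨ sumList-dipole z a b ⟩
    z a - z b                                                    ∎
    where open ≡-Reasoning

kirchhoff-cong : ∀ n {R R′ : Vertex n → Vertex n → ℚ} → (∀ a b → R a b ≡ R′ a b) → kirchhoff n R ≡ kirchhoff n R′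
kirchhoff-cong n R≡R′ = cong (λ xs → ½ * sumList xs)
  (Listₚ.concatMap-cong (λ a → Listₚ.map-cong (R≡R′ a) (allVertices n)) (allVertices n))

U W : ℕ → ℕ
U zero    = 1
U (suc k) = 2 ℕ.* U k ℕ.+ 3 ℕ.* W k
W zero    = 0
W (suc k) = 2 ℕ.* W k ℕ.+ U k

U²≡3W²+1 : ∀ k → U k ℕ.* U k ≡ 3 ℕ.* (W k ℕ.* W k) ℕ.+ 1
U²≡3W²+1 zero    = refl
U²≡3W²+1 (suc k) = begin
  (2 ℕ.* u ℕ.+ 3 ℕ.* w) ℕ.* (2 ℕ.* u ℕ.+ 3 ℕ.* w)           ≡⟨ expand u w ⟩
  3 ℕ.* (u ℕ.* u ℕ.+ 4 ℕ.* (u ℕ.* w) ℕ.+ 3 ℕ.* (w ℕ.* w)) ℕ.+ u ℕ.* u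
    ≡⟨ cong (3 ℕ.* (u ℕ.* u ℕ.+ 4 ℕ.* (u ℕ.* w) ℕ.+ 3 ℕ.* (w ℕ.* w)) ℕ.+_) (U²≡3W²+1 k) ⟩
  3 ℕ.* (u ℕ.* u ℕ.+ 4 ℕ.* (u ℕ.* w) ℕ.+ 3 ℕ.* (w ℕ.* w)) ℕ.+ (3 ℕ.* (w ℕ.* w) ℕ.+ 1) ≡⟨ collect u w ⟩
  3 ℕ.* ((2 ℕ.* w ℕ.+ u) ℕ.* (2 ℕ.* w ℕ.+ u)) ℕ.+ 1        ∎
  where
  open ≡-Reasoning
  u w : ℕ
  u = U k
  w = W k
  expand : ∀ u w → (2 ℕ.* u ℕ.+ 3 ℕ.* w) ℕ.* (2 ℕ.* u ℕ.+ 3 ℕ.* w)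
                   ≡ 3 ℕ.* (u ℕ.* u ℕ.+ 4 ℕ.* (u ℕ.* w) ℕ.+ 3 ℕ.* (w ℕ.* w)) ℕ.+ u ℕ.* u
  expand = ℕ-Solver.solve-∀
  collect : ∀ u w → 3 ℕ.* (u ℕ.* u ℕ.+ 4 ℕ.* (u ℕ.* w) ℕ.+ 3 ℕ.* (w ℕ.* w)) ℕ.+ (3 ℕ.* (w ℕ.* w) ℕ.+ 1)
                    ≡ 3 ℕ.* ((2 ℕ.* w ℕ.+ u) ℕ.* (2 ℕ.* w ℕ.+ u)) ℕ.+ 1
  collect = ℕ-Solver.solve-∀

W-recurrence : ∀ k → W (2 ℕ.+ k) ℕ.+ W k ≡ 4 ℕ.* W (1 ℕ.+ k)
W-recurrence k = identity (W k) (U k)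
  where
  identity : ∀ w u → 2 ℕ.* (2 ℕ.* w ℕ.+ u) ℕ.+ (2 ℕ.* u ℕ.+ 3 ℕ.* w) ℕ.+ w ≡ 4 ℕ.* (2 ℕ.* w ℕ.+ u)
  identity = ℕ-Solver.solve-∀

W-boundary : ∀ k → 4 ℕ.* W (suc k) ≡ 2 ℕ.* W k ℕ.+ 2 ℕ.* U (suc k)
W-boundary k = identity (W k) (U k)
  where
  identity : ∀ w u → 4 ℕ.* (2 ℕ.* w ℕ.+ u) ≡ 2 ℕ.* w ℕ.+ 2 ℕ.* (2 ℕ.* u ℕ.+ 3 ℕ.* w)
  identity = ℕ-Solver.solve-∀

1≤U : ∀ k → 1 ≤ U k
1≤U zero    = ℕₚ.≤-refl
1≤U (suc k) = ℕₚ.≤-trans (1≤U k) (ℕₚ.≤-trans (ℕₚ.m≤m+n (U k) (U k ℕ.+ 0)) (ℕₚ.m≤m+n (2 ℕ.* U k) (3 ℕ.* W k)))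

1<U-suc : ∀ k → 1 < U (suc k)
1<U-suc k = ℕₚ.≤-trans (ℕₚ.*-monoʳ-≤ 2 (1≤U k)) (ℕₚ.m≤m+n (2 ℕ.* U k) (3 ℕ.* W k))

2-√3^≡U-W√3 : ∀ k → (embed (ℕtoℚ 2) ⊖ √3) ^ k ≡ ⟨ ℕtoℚ (U k) , - ℕtoℚ (W k) ⟩
2-√3^≡U-W√3 zero    = refl
2-√3^≡U-W√3 (suc k) = begin
  (embed (ℕtoℚ 2) ⊖ √3) ⊗ (embed (ℕtoℚ 2) ⊖ √3) ^ k   ≡⟨ cong ((embed (ℕtoℚ 2) ⊖ √3) ⊗_) (2-√3^≡U-W√3 k) ⟩
  (embed (ℕtoℚ 2) ⊖ √3) ⊗ ⟨ u , - w ⟩                  ≡⟨ cong₂ ⟨_,_⟩ (re-part u w) (im-part u w) ⟩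
  ⟨ ℕtoℚ 2 * u + ℕtoℚ 3 * w , - (ℕtoℚ 2 * w + u) ⟩     ≡⟨ cong₂ (λ a b → ⟨ a , - b ⟩) (sym (cast-+* 2 (U k) 3 (W k))) (sym (trans (ℕtoℚ-+ (2 ℕ.* W k) (U k)) (cong (_+ u) (ℕtoℚ-* 2 (W k))))) ⟩
  ⟨ ℕtoℚ (U (suc k)) , - ℕtoℚ (W (suc k)) ⟩            ∎
  where
  open ≡-Reasoning
  u w : ℚ
  u = ℕtoℚ (U k)
  w = ℕtoℚ (W k)
  re-part : ∀ u w → (ℕtoℚ 2 - 0ℚ) * u + ℕtoℚ 3 * ((0ℚ - 1ℚ) * (- w)) ≡ ℕtoℚ 2 * u + ℕtoℚ 3 * w
  re-part = solve-∀ ℚ-ring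
  im-part : ∀ u w → (ℕtoℚ 2 - 0ℚ) * (- w) + (0ℚ - 1ℚ) * u ≡ - (ℕtoℚ 2 * w + u)
  im-part = solve-∀ ℚ-ring
  cast-+* : ∀ a x b y → ℕtoℚ (a ℕ.* x ℕ.+ b ℕ.* y) ≡ ℕtoℚ a * ℕtoℚ x + ℕtoℚ b * ℕtoℚ y
  cast-+* a x b y = trans (ℕtoℚ-+ (a ℕ.* x) (b ℕ.* y)) (cong₂ _+_ (ℕtoℚ-* a x) (ℕtoℚ-* b y))

module _ (u w : ℚ) (norm≡1 : u * u ≡ ℕtoℚ 3 * (w * w) + 1ℚ) (u-1≢0 : u - 1ℚ ≢ 0ℚ) where

  private
    e : ℚ
    e = inv (u - 1ℚ)

    [u-1]e≡1 : (u - 1ℚ) * e ≡ 1ℚ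
    [u-1]e≡1 = *-inv u-1≢0

  recip-1-[u-w√3] : recip (embed 1ℚ ⊖ ⟨ u , - w ⟩) ≡ ⟨ ½ , ½ * (w * e) ⟩
  recip-1-[u-w√3] = cong₂ ⟨_,_⟩ (trans (cong ((1ℚ - u) *_) I≡-½e) re-part)
                                (trans (cong ((- (0ℚ - - w)) *_) I≡-½e) (im-part w e))
    where
    open ≡-Reasoning
    v norm : ℚ
    v = ℕtoℚ 3 * (w * w) + 1ℚ
    norm = (1ℚ - u) * (1ℚ - u) - ℕtoℚ 3 * ((0ℚ - - w) * (0ℚ - - w))
    expand : ∀ u w → (1ℚ - u) * (1ℚ - u) - ℕtoℚ 3 * ((0ℚ - - w) * (0ℚ - - w))
                     ≡ (u * u - (ℕtoℚ 3 * (w * w) + 1ℚ)) - ℕtoℚ 2 * (u - 1ℚ)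
    expand = solve-∀ ℚ-ring
    cancel : ∀ u v e → ((v - v) - ℕtoℚ 2 * (u - 1ℚ)) * (- ½ * e) ≡ (u - 1ℚ) * e
    cancel = solve-∀ ℚ-ring
    halve : ∀ u e → (1ℚ - u) * (- ½ * e) ≡ ½ * ((u - 1ℚ) * e)
    halve = solve-∀ ℚ-ring
    im-part : ∀ w e → (- (0ℚ - - w)) * (- ½ * e) ≡ ½ * (w * e)
    im-part = solve-∀ ℚ-ring
    I≡-½e : inv norm ≡ - ½ * e
    I≡-½e = inv-unique norm (begin
      norm * (- ½ * e)
        ≡⟨ cong (_* (- ½ * e)) (trans (expand u w) (cong (λ t → (t - v) - ℕtoℚ 2 * (u - 1ℚ)) norm≡1)) ⟩
      ((v - v) - ℕtoℚ 2 * (u - 1ℚ)) * (- ½ * e) ≡⟨ cancel u v e ⟩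
      (u - 1ℚ) * e                              ≡⟨ [u-1]e≡1 ⟩
      1ℚ                                        ∎)
    re-part : (1ℚ - u) * (- ½ * e) ≡ ½
    re-part = trans (halve u e) (trans (cong (½ *_) [u-1]e≡1) (ℚₚ.*-identityʳ ½))

  cayley-div-√3 : ∀ c → embed c ⊗ recip √3 ⊗ (embed (ℕtoℚ 2) ⊗ recip (embed 1ℚ ⊖ ⟨ u , - w ⟩) ⊖ embed 1ℚ)
                        ≡ embed (c * (w * e))
  cayley-div-√3 c = trans (cong (λ y → embed c ⊗ recip √3 ⊗ (embed (ℕtoℚ 2) ⊗ y ⊖ embed 1ℚ)) recip-1-[u-w√3])
                          (evaluate c (w * e))
    where
    evaluate : ∀ c y → embed c ⊗ recip √3 ⊗ (embed (ℕtoℚ 2) ⊗ ⟨ ½ , ½ * y ⟩ ⊖ embed 1ℚ) ≡ embed (c * y)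
    evaluate c y = cong₂ ⟨_,_⟩ (re-part c y) (im-part c y)
      where
      ⅓ : ℚ
      ⅓ = ℚ.1/ ℕtoℚ 3
      re-part : ∀ c y → (c * 0ℚ + ℕtoℚ 3 * (0ℚ * ⅓)) * ((ℕtoℚ 2 * ½ + ℕtoℚ 3 * (0ℚ * (½ * y))) - 1ℚ)
                        + ℕtoℚ 3 * ((c * ⅓ + 0ℚ * 0ℚ) * ((ℕtoℚ 2 * (½ * y) + 0ℚ * ½) - 0ℚ)) ≡ c * y
      re-part = solve-∀ ℚ-ring
      im-part : ∀ c y → (c * 0ℚ + ℕtoℚ 3 * (0ℚ * ⅓)) * ((ℕtoℚ 2 * (½ * y) + 0ℚ * ½) - 0ℚ)
                        + (c * ⅓ + 0ℚ * 0ℚ) * ((ℕtoℚ 2 * ½ + ℕtoℚ 3 * (0ℚ * (½ * y))) - 1ℚ) ≡ 0ℚ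
      im-part = solve-∀ ℚ-ring

U-suc-1≢0 : ∀ k → ℕtoℚ (U (suc k)) - 1ℚ ≢ 0ℚ
U-suc-1≢0 k eq = ℕₚ.<⇒≢ (1<U-suc k) (sym (ℕtoℚ-injective (begin
  ℕtoℚ (U (suc k))                  ≡⟨ add-back (ℕtoℚ (U (suc k))) ⟩
  (ℕtoℚ (U (suc k)) - 1ℚ) + 1ℚ      ≡⟨ cong (_+ 1ℚ) eq ⟩
  0ℚ + 1ℚ                           ≡⟨⟩
  ℕtoℚ 1                            ∎)))
  where
  open ≡-Reasoning
  add-back : ∀ x → x ≡ (x - 1ℚ) + 1ℚ
  add-back = solve-∀ ℚ-ring

kirchhoffClosedForm : ℕ → ℚ
kirchhoffClosedForm n = ℕtoℚ n * (ℕtoℚ n * ℕtoℚ n - 1ℚ) * inv (ℕtoℚ 6)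
                      + ℕtoℚ n * ℕtoℚ n * (ℕtoℚ (W n) * inv (ℕtoℚ (U n) - 1ℚ))

rhs≡kirchhoffClosedForm : ∀ n′ → rhs (suc n′) ≡ embed (kirchhoffClosedForm (suc n′))
rhs≡kirchhoffClosedForm n′ = begin
  rhs N
    ≡⟨ cong (λ y → embed (ℕtoℚ (N ℕ.* (N ℕ.* N ∸ 1)) * inv (ℕtoℚ 6)) ⊕ embed (ℕtoℚ (N ℕ.* N))
                     ⊗ recip √3 ⊗ (embed (ℕtoℚ 2) ⊗ recip (embed 1ℚ ⊖ y) ⊖ embed 1ℚ))
            (2-√3^≡U-W√3 N) ⟩
  embed (ℕtoℚ (N ℕ.* (N ℕ.* N ∸ 1)) * inv (ℕtoℚ 6)) ⊕ embed (ℕtoℚ (N ℕ.* N))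
    ⊗ recip √3 ⊗ (embed (ℕtoℚ 2) ⊗ recip (embed 1ℚ ⊖ ⟨ u , - w ⟩) ⊖ embed 1ℚ)
    ≡⟨ cong (embed (ℕtoℚ (N ℕ.* (N ℕ.* N ∸ 1)) * inv (ℕtoℚ 6)) ⊕_) (cayley-div-√3 u w norm≡1 (U-suc-1≢0 n′) (ℕtoℚ (N ℕ.* N))) ⟩
  embed (ℕtoℚ (N ℕ.* (N ℕ.* N ∸ 1)) * inv (ℕtoℚ 6)) ⊕ embed (ℕtoℚ (N ℕ.* N) * (w * inv (u - 1ℚ)))
    ≡⟨ cong₂ (λ a b → ⟨ a * inv (ℕtoℚ 6) + b * (w * inv (u - 1ℚ)) , 0ℚ ⟩) cubic (ℕtoℚ-* N N) ⟩
  embed (kirchhoffClosedForm N) ∎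
  where
  open ≡-Reasoning
  N : ℕ
  N = suc n′
  u w : ℚ
  u = ℕtoℚ (U N)
  w = ℕtoℚ (W N)
  norm≡1 : u * u ≡ ℕtoℚ 3 * (w * w) + 1ℚ
  norm≡1 = begin
    u * u                                       ≡⟨ ℕtoℚ-* (U N) (U N) ⟨
    ℕtoℚ (U N ℕ.* U N)                          ≡⟨ cong ℕtoℚ (U²≡3W²+1 N) ⟩
    ℕtoℚ (3 ℕ.* (W N ℕ.* W N) ℕ.+ 1)            ≡⟨ ℕtoℚ-+ (3 ℕ.* (W N ℕ.* W N)) 1 ⟩
    ℕtoℚ (3 ℕ.* (W N ℕ.* W N)) + 1ℚ             ≡⟨ cong (_+ 1ℚ) (trans (ℕtoℚ-* 3 (W N ℕ.* W N)) (cong (ℕtoℚ 3 *_) (ℕtoℚ-* (W N) (W N)))) ⟩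
    ℕtoℚ 3 * (w * w) + 1ℚ                       ∎
  -- Since N = suc n′, N * N ∸ 1 computes to n′ + n′ * N.
  cubic : ℕtoℚ (N ℕ.* (N ℕ.* N ∸ 1)) ≡ ℕtoℚ N * (ℕtoℚ N * ℕtoℚ N - 1ℚ)
  cubic = begin
    ℕtoℚ (N ℕ.* (n′ ℕ.+ n′ ℕ.* N))      ≡⟨ trans (ℕtoℚ-* N (n′ ℕ.+ n′ ℕ.* N)) (cong (ℕtoℚ N *_) (trans (ℕtoℚ-+ n′ (n′ ℕ.* N)) (cong (ℕtoℚ n′ +_) (ℕtoℚ-* n′ N)))) ⟩
    ℕtoℚ N * (m + m * ℕtoℚ N)           ≡⟨ cong (λ x → x * (m + m * x)) (ℕtoℚ-suc n′) ⟩
    (1ℚ + m) * (m + m * (1ℚ + m))       ≡⟨ identity m ⟩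
    (1ℚ + m) * ((1ℚ + m) * (1ℚ + m) - 1ℚ) ≡⟨ cong (λ x → x * (x * x - 1ℚ)) (ℕtoℚ-suc n′) ⟨
    ℕtoℚ N * (ℕtoℚ N * ℕtoℚ N - 1ℚ)     ∎
    where
    m : ℚ
    m = ℕtoℚ n′
    identity : ∀ m → (1ℚ + m) * (m + m * (1ℚ + m)) ≡ (1ℚ + m) * ((1ℚ + m) * (1ℚ + m) - 1ℚ)
    identity = solve-∀ ℚ-ring

module Prism (n′ : ℕ) where

  N : ℕ
  N = suc n′

  [m%N+n]%N≡[m+n]%N : ∀ m n → (m % N ℕ.+ n) % N ≡ (m ℕ.+ n) % N
  [m%N+n]%N≡[m+n]%N m n = begin
    (m % N ℕ.+ n) % N          ≡⟨ %-distribˡ-+ (m % N) n N ⟩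
    (m % N % N ℕ.+ n % N) % N  ≡⟨ cong (λ t → (t ℕ.+ n % N) % N) (m%n%n≡m%n m N) ⟩
    (m % N ℕ.+ n % N) % N      ≡⟨ %-distribˡ-+ m n N ⟨
    (m ℕ.+ n) % N              ∎
    where open ≡-Reasoning

  [m+n%N]%N≡[m+n]%N : ∀ m n → (m ℕ.+ n % N) % N ≡ (m ℕ.+ n) % N
  [m+n%N]%N≡[m+n]%N m n = trans (cong (_% N) (ℕₚ.+-comm m (n % N)))
    (trans ([m%N+n]%N≡[m+n]%N n m) (cong (_% N) (ℕₚ.+-comm n m)))

  [m+N]%N≡m : ∀ {m} → m < N → (m ℕ.+ N) % N ≡ m
  [m+N]%N≡m {m} m<N = trans ([m+n]%n≡m%n m N) (m<n⇒m%n≡m m<N)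

  prev : Fin N → Fin N
  prev j = (toℕ j ℕ.+ n′) mod N

  toℕ-next : ∀ j → toℕ (next N j) ≡ suc (toℕ j) % N
  toℕ-next j = Finₚ.toℕ-fromℕ< _

  toℕ-prev : ∀ j → toℕ (prev j) ≡ (toℕ j ℕ.+ n′) % N
  toℕ-prev j = Finₚ.toℕ-fromℕ< _

  next-prev : ∀ j → next N (prev j) ≡ j
  next-prev j = Finₚ.toℕ-injective (begin
    toℕ (next N (prev j))            ≡⟨ toℕ-next (prev j) ⟩
    suc (toℕ (prev j)) % N           ≡⟨ cong (λ t → suc t % N) (toℕ-prev j) ⟩
    (1 ℕ.+ (toℕ j ℕ.+ n′) % N) % N   ≡⟨ [m+n%N]%N≡[m+n]%N 1 (toℕ j ℕ.+ n′) ⟩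
    suc (toℕ j ℕ.+ n′) % N           ≡⟨ cong (_% N) (ℕₚ.+-suc (toℕ j) n′) ⟨
    (toℕ j ℕ.+ N) % N                ≡⟨ [m+N]%N≡m (Finₚ.toℕ<n j) ⟩
    toℕ j                            ∎)
    where open ≡-Reasoning

  prev-next : ∀ j → prev (next N j) ≡ j
  prev-next j = Finₚ.toℕ-injective (begin
    toℕ (prev (next N j))            ≡⟨ toℕ-prev (next N j) ⟩
    (toℕ (next N j) ℕ.+ n′) % N      ≡⟨ cong (λ t → (t ℕ.+ n′) % N) (toℕ-next j) ⟩
    (suc (toℕ j) % N ℕ.+ n′) % N     ≡⟨ [m%N+n]%N≡[m+n]%N (suc (toℕ j)) n′ ⟩
    suc (toℕ j ℕ.+ n′) % N           ≡⟨ cong (_% N) (ℕₚ.+-suc (toℕ j) n′) ⟨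
    (toℕ j ℕ.+ N) % N                ≡⟨ [m+N]%N≡m (Finₚ.toℕ<n j) ⟩
    toℕ j                            ∎)
    where open ≡-Reasoning

  offset : Fin N → Fin N → ℕ
  offset j i = (toℕ j ℕ.+ (N ∸ toℕ i)) % N

  offset<N : ∀ j i → offset j i < N
  offset<N j i = m%n<n (toℕ j ℕ.+ (N ∸ toℕ i)) N

  offset-next : ∀ j i → offset (next N j) i ≡ suc (offset j i) % N
  offset-next j i = begin
    (toℕ (next N j) ℕ.+ (N ∸ toℕ i)) % N   ≡⟨ cong (λ t → (t ℕ.+ (N ∸ toℕ i)) % N) (toℕ-next j) ⟩
    (suc (toℕ j) % N ℕ.+ (N ∸ toℕ i)) % N  ≡⟨ [m%N+n]%N≡[m+n]%N (suc (toℕ j)) (N ∸ toℕ i) ⟩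
    suc (toℕ j ℕ.+ (N ∸ toℕ i)) % N        ≡⟨ [m+n%N]%N≡[m+n]%N 1 (toℕ j ℕ.+ (N ∸ toℕ i)) ⟨
    suc (offset j i) % N                   ∎
    where open ≡-Reasoning

  offset-prev : ∀ j i → offset (prev j) i ≡ (offset j i ℕ.+ n′) % N
  offset-prev j i = begin
    (toℕ (prev j) ℕ.+ (N ∸ toℕ i)) % N              ≡⟨ cong (λ t → (t ℕ.+ (N ∸ toℕ i)) % N) (toℕ-prev j) ⟩
    ((toℕ j ℕ.+ n′) % N ℕ.+ (N ∸ toℕ i)) % N        ≡⟨ [m%N+n]%N≡[m+n]%N (toℕ j ℕ.+ n′) (N ∸ toℕ i) ⟩
    (toℕ j ℕ.+ n′ ℕ.+ (N ∸ toℕ i)) % N              ≡⟨ cong (_% N) (swap (toℕ j) n′ (N ∸ toℕ i)) ⟩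
    (toℕ j ℕ.+ (N ∸ toℕ i) ℕ.+ n′) % N              ≡⟨ [m%N+n]%N≡[m+n]%N (toℕ j ℕ.+ (N ∸ toℕ i)) n′ ⟨
    (offset j i ℕ.+ n′) % N                         ∎
    where
    open ≡-Reasoning
    swap : ∀ a b c → a ℕ.+ b ℕ.+ c ≡ a ℕ.+ c ℕ.+ b
    swap = ℕ-Solver.solve-∀

  offset-self : ∀ i → offset i i ≡ 0
  offset-self i = trans (cong (_% N) (ℕₚ.m+[n∸m]≡n (ℕₚ.<⇒≤ (Finₚ.toℕ<n i)))) (n%n≡0 N)

  offset≡0⇒≡ : ∀ {j i} → offset j i ≡ 0 → j ≡ i
  offset≡0⇒≡ {j} {i} eq = Finₚ.toℕ-injective (begin
    toℕ j                                     ≡⟨ [m+N]%N≡m (Finₚ.toℕ<n j) ⟨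
    (toℕ j ℕ.+ N) % N                         ≡⟨ cong (λ t → (toℕ j ℕ.+ t) % N) (ℕₚ.m∸n+n≡m (ℕₚ.<⇒≤ (Finₚ.toℕ<n i))) ⟨
    (toℕ j ℕ.+ ((N ∸ toℕ i) ℕ.+ toℕ i)) % N   ≡⟨ cong (_% N) (ℕₚ.+-assoc (toℕ j) (N ∸ toℕ i) (toℕ i)) ⟨
    (toℕ j ℕ.+ (N ∸ toℕ i) ℕ.+ toℕ i) % N     ≡⟨ [m%N+n]%N≡[m+n]%N (toℕ j ℕ.+ (N ∸ toℕ i)) (toℕ i) ⟨
    (offset j i ℕ.+ toℕ i) % N                ≡⟨ cong (λ t → (t ℕ.+ toℕ i) % N) eq ⟩
    toℕ i % N                                 ≡⟨ m<n⇒m%n≡m (Finₚ.toℕ<n i) ⟩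
    toℕ i                                     ∎)
    where open ≡-Reasoning

  sumRange-rotate : ∀ (f : ℕ → ℚ) → sumRange N (λ k → f (suc k % N)) ≡ sumRange N f
  sumRange-rotate f = begin
    sumRange n′ (λ k → f (suc k % N)) + f (N % N)
      ≡⟨ cong₂ _+_ (sumRange-cong n′ (λ k k<n′ → cong f (m<n⇒m%n≡m (ℕ.s≤s k<n′)))) (cong f (n%n≡0 N)) ⟩
    sumRange n′ (f ∘ suc) + f 0   ≡⟨ ℚₚ.+-comm (sumRange n′ (f ∘ suc)) (f 0) ⟩
    f 0 + sumRange n′ (f ∘ suc)   ≡⟨ sumRange-cons n′ f ⟨
    sumRange N f                  ∎
    where open ≡-Reasoning

  sumRange-shift : ∀ m (f : ℕ → ℚ) → sumRange N (λ k → f ((k ℕ.+ m) % N)) ≡ sumRange N f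
  sumRange-shift zero    f = sumRange-cong N (λ k k<N → cong f (trans (cong (_% N) (ℕₚ.+-identityʳ k)) (m<n⇒m%n≡m k<N)))
  sumRange-shift (suc m) f = trans
    (sumRange-cong N (λ k _ → cong f (trans (cong (_% N) (ℕₚ.+-suc k m)) (sym ([m%N+n]%N≡[m+n]%N (suc k) m)))))
    (trans (sumRange-rotate (λ k → f ((k ℕ.+ m) % N))) (sumRange-shift m f))

  sumFin-offset : ∀ (f : ℕ → ℚ) i → sumFin (λ j → f (offset j i)) ≡ sumRange N f
  sumFin-offset f i = trans (sumFin-toℕ N (λ k → f ((k ℕ.+ (N ∸ toℕ i)) % N))) (sumRange-shift (N ∸ toℕ i) f)

  cycleOutflow : (Vertex N → ℚ) → Vertex N → Bool → ℚ
  cycleOutflow x v t = sumFin (λ j → edgeOutflow x v ((t , j) , (t , next N j)))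

  rungOutflow : (Vertex N → ℚ) → Vertex N → ℚ
  rungOutflow x v = sumFin (λ j → edgeOutflow x v (p j , q j))

  outflow-split : ∀ x v → outflow N x v ≡ cycleOutflow x v false + (cycleOutflow x v true + rungOutflow x v)
  outflow-split x v = begin
    sumList (map (edgeOutflow x v) (concatMap triple (allFin N)))
      ≡⟨ cong sumList (Listₚ.map-concatMap (edgeOutflow x v) triple (allFin N)) ⟩
    sumList (concatMap (map (edgeOutflow x v) ∘ triple) (allFin N))
      ≡⟨ sumList-concatMap (map (edgeOutflow x v) ∘ triple) (allFin N) ⟩
    sumList (map (λ j → fp j + (fq j + (fr j + 0ℚ))) (allFin N))
      ≡⟨ sumList-cong (λ j → cong (λ t → fp j + (fq j + t)) (ℚₚ.+-identityʳ (fr j))) (allFin N) ⟩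
    sumList (map (λ j → fp j + (fq j + fr j)) (allFin N))
      ≡⟨ sumList-allFin (λ j → fp j + (fq j + fr j)) ⟩
    sumFin (λ j → fp j + (fq j + fr j))
      ≡⟨ trans (sumFin-+ fp (λ j → fq j + fr j)) (cong (sumFin fp +_) (sumFin-+ fq fr)) ⟩
    sumFin fp + (sumFin fq + sumFin fr) ∎
    where
    open ≡-Reasoning
    triple : Fin N → List (Vertex N × Vertex N)
    triple j = (p j , p (next N j)) ∷ (q j , q (next N j)) ∷ (p j , q j) ∷ []
    fp fq fr : Fin N → ℚ
    fp j = edgeOutflow x v (p j , p (next N j))
    fq j = edgeOutflow x v (q j , q (next N j))
    fr j = edgeOutflow x v (p j , q j)

  cycleOutflow-own : ∀ x s i → cycleOutflow x (s , i) s ≡ (x (s , i) - x (s , next N i)) + (x (s , i) - x (s , prev i))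
  cycleOutflow-own x s i = begin
    cycleOutflow x (s , i) s
      ≡⟨ sumFin-+ (λ j → δ (s , i) (s , j) * (x (s , j) - x (s , next N j)))
                  (λ j → δ (s , i) (s , next N j) * (x (s , next N j) - x (s , j))) ⟩
    sumFin (λ j → δ (s , i) (s , j) * (x (s , j) - x (s , next N j)))
      + sumFin (λ j → δ (s , i) (s , next N j) * (x (s , next N j) - x (s , j)))
      ≡⟨ cong₂ _+_ (sumFin-δ-hit (s , i) (vertex s) (λ j → x (s , j) - x (s , next N j)) i refl (λ j → cong proj₂))
                   (sumFin-δ-hit (s , i) (λ j → (s , next N j)) (λ j → x (s , next N j) - x (s , j)) (prev i) (cong (vertex s) (next-prev i))
                                 (λ j eq → trans (sym (prev-next j)) (cong prev (cong proj₂ eq)))) ⟩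
    (x (s , i) - x (s , next N i)) + (x (s , next N (prev i)) - x (s , prev i))
      ≡⟨ cong (λ k → (x (s , i) - x (s , next N i)) + (x (s , k) - x (s , prev i))) (next-prev i) ⟩
    (x (s , i) - x (s , next N i)) + (x (s , i) - x (s , prev i)) ∎
    where open ≡-Reasoning

  cycleOutflow-other : ∀ x {s t} i → s ≢ t → cycleOutflow x (s , i) t ≡ 0ℚ
  cycleOutflow-other x {s} {t} i s≢t = begin
    cycleOutflow x (s , i) t
      ≡⟨ sumFin-+ (λ j → δ (s , i) (t , j) * (x (t , j) - x (t , next N j)))
                  (λ j → δ (s , i) (t , next N j) * (x (t , next N j) - x (t , j))) ⟩
    sumFin (λ j → δ (s , i) (t , j) * (x (t , j) - x (t , next N j)))
      + sumFin (λ j → δ (s , i) (t , next N j) * (x (t , next N j) - x (t , j)))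
      ≡⟨ cong₂ _+_ (sumFin-δ-miss (s , i) (vertex t) (λ j → x (t , j) - x (t , next N j)) (λ j eq → s≢t (sym (cong proj₁ eq))))
                   (sumFin-δ-miss (s , i) (λ j → (t , next N j)) (λ j → x (t , next N j) - x (t , j)) (λ j eq → s≢t (sym (cong proj₁ eq)))) ⟩
    0ℚ + 0ℚ ≡⟨⟩
    0ℚ ∎
    where open ≡-Reasoning

  rungOutflow-local : ∀ x s i → rungOutflow x (s , i) ≡ x (s , i) - x (not s , i)
  rungOutflow-local x s i = trans
    (sumFin-+ (λ j → δ (s , i) (p j) * (x (p j) - x (q j))) (λ j → δ (s , i) (q j) * (x (q j) - x (p j))))
    (layer s)
    where
    layer : ∀ s → sumFin (λ j → δ (s , i) (p j) * (x (p j) - x (q j))) + sumFin (λ j → δ (s , i) (q j) * (x (q j) - x (p j)))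
                  ≡ x (s , i) - x (not s , i)
    layer false = trans (cong₂ _+_ (sumFin-δ-hit (p i) p (λ j → x (p j) - x (q j)) i refl (λ j → cong proj₂))
                                   (sumFin-δ-miss (p i) q (λ j → x (q j) - x (p j)) (λ j ())))
                        (ℚₚ.+-identityʳ (x (p i) - x (q i)))
    layer true = trans (cong₂ _+_ (sumFin-δ-miss (q i) p (λ j → x (p j) - x (q j)) (λ j ()))
                                  (sumFin-δ-hit (q i) q (λ j → x (q j) - x (p j)) i refl (λ j → cong proj₂)))
                       (ℚₚ.+-identityˡ (x (q i) - x (p i)))

  outflow-local : ∀ x s i → outflow N x (s , i)
                  ≡ (x (s , i) - x (s , next N i)) + (x (s , i) - x (s , prev i)) + (x (s , i) - x (not s , i))
  outflow-local x false i = begin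
    outflow N x (p i)
      ≡⟨ outflow-split x (p i) ⟩
    cycleOutflow x (p i) false + (cycleOutflow x (p i) true + rungOutflow x (p i))
      ≡⟨ cong₂ (λ a b → a + (b + rungOutflow x (p i))) (cycleOutflow-own x false i) (cycleOutflow-other x {false} {true} i λ ()) ⟩
    cyc + (0ℚ + rungOutflow x (p i))
      ≡⟨ cong (cyc +_) (trans (ℚₚ.+-identityˡ (rungOutflow x (p i))) (rungOutflow-local x false i)) ⟩
    cyc + (x (p i) - x (q i)) ∎
    where
    open ≡-Reasoning
    cyc : ℚ
    cyc = (x (p i) - x (p (next N i))) + (x (p i) - x (p (prev i)))
  outflow-local x true i = begin
    outflow N x (q i)
      ≡⟨ outflow-split x (q i) ⟩
    cycleOutflow x (q i) false + (cycleOutflow x (q i) true + rungOutflow x (q i))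
      ≡⟨ cong₂ (λ a b → a + (b + rungOutflow x (q i))) (cycleOutflow-other x {true} {false} i λ ()) (cycleOutflow-own x true i) ⟩
    0ℚ + (cyc + rungOutflow x (q i))
      ≡⟨ trans (ℚₚ.+-identityˡ (cyc + rungOutflow x (q i))) (cong (cyc +_) (rungOutflow-local x true i)) ⟩
    cyc + (x (q i) - x (p i)) ∎
    where
    open ≡-Reasoning
    cyc : ℚ
    cyc = (x (q i) - x (q (next N i))) + (x (q i) - x (q (prev i)))

  Δ : (ℕ → ℚ) → ℕ → ℚ
  Δ f k = (f k - f (suc k % N)) + (f k - f ((k ℕ.+ n′) % N))

  module _ (f : ℕ → ℚ) (f-periodic : f N ≡ f 0) where

    f[1+k%N]≡f[1+k] : ∀ {k} → k < N → f (suc k % N) ≡ f (suc k)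
    f[1+k%N]≡f[1+k] {k} k<N with ℕₚ.m≤n⇒m<n∨m≡n k<N
    ... | inj₁ 1+k<N = cong f (m<n⇒m%n≡m 1+k<N)
    ... | inj₂ 1+k≡N = trans (cong f (trans (cong (_% N) 1+k≡N) (n%n≡0 N))) (trans (sym f-periodic) (cong f (sym 1+k≡N)))

    Δ-zero : Δ f 0 ≡ (f 0 - f 1) + (f 0 - f n′)
    Δ-zero = cong₂ (λ a b → (f 0 - a) + (f 0 - b)) (f[1+k%N]≡f[1+k] (ℕ.s≤s ℕ.z≤n)) (cong f (m<n⇒m%n≡m (ℕₚ.n<1+n n′)))

    Δ-suc : ∀ {k} → suc k < N → Δ f (suc k) ≡ (f (suc k) - f (suc (suc k))) + (f (suc k) - f k)
    Δ-suc {k} 1+k<N = cong₂ (λ a b → (f (suc k) - a) + (f (suc k) - b)) (f[1+k%N]≡f[1+k] 1+k<N)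
      (cong f (trans (cong (_% N) (sym (ℕₚ.+-suc k n′))) ([m+N]%N≡m (ℕₚ.<-trans (ℕₚ.n<1+n k) 1+k<N))))

  impulse : Bool → ℕ → ℚ
  impulse false zero = 1ℚ
  impulse _     _    = 0ℚ

  -- The unit current is extracted uniformly at all 2N vertices, which makes the Poisson
  -- equations below solvable on the cycle.
  c : ℚ
  c = inv (ℕtoℚ N + ℕtoℚ N)

  [N+N]c≡1 : (ℕtoℚ N + ℕtoℚ N) * c ≡ 1ℚ
  [N+N]c≡1 = *-inv (λ eq → ℕtoℚ-suc≢0 (n′ ℕ.+ N) (trans (ℕtoℚ-+ N N) eq))

  e : ℚ
  e = inv (ℕtoℚ (U N) - 1ℚ)

  [U-1]e≡1 : (ℕtoℚ (U N) - 1ℚ) * e ≡ 1ℚ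
  [U-1]e≡1 = *-inv (U-suc-1≢0 n′)

  parabola : ℚ → ℚ → ℚ
  parabola n x = - (x * (n - x)) * c

  S : ℕ → ℚ
  S k = parabola (ℕtoℚ N) (ℕtoℚ k)

  S-periodic : S N ≡ S 0
  S-periodic = vanish (ℕtoℚ N) c
    where
    vanish : ∀ n c → - (n * (n - n)) * c ≡ - (0ℚ * (n - 0ℚ)) * c
    vanish = solve-∀ ℚ-ring

  ΔS : ∀ k → k < N → Δ S k ≡ impulse false k - (c + c)
  ΔS zero _ = begin
    Δ S 0                                                         ≡⟨ Δ-zero S S-periodic ⟩
    (S 0 - S 1) + (S 0 - S n′)                                    ≡⟨ cong (λ n → (parabola n 0ℚ - parabola n 1ℚ) + (parabola n 0ℚ - parabola n m)) (ℕtoℚ-suc n′) ⟩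
    (parabola (1ℚ + m) 0ℚ - parabola (1ℚ + m) 1ℚ) + (parabola (1ℚ + m) 0ℚ - parabola (1ℚ + m) m)
                                                                  ≡⟨ expand m c ⟩
    ((1ℚ + m) + (1ℚ + m)) * c - (c + c)                           ≡⟨ cong (λ n → (n + n) * c - (c + c)) (ℕtoℚ-suc n′) ⟨
    (ℕtoℚ N + ℕtoℚ N) * c - (c + c)                               ≡⟨ cong (_- (c + c)) [N+N]c≡1 ⟩
    1ℚ - (c + c)                                                  ∎
    where
    open ≡-Reasoning
    m : ℚ
    m = ℕtoℚ n′
    expand : ∀ m c → (- (0ℚ * ((1ℚ + m) - 0ℚ)) * c - - (1ℚ * ((1ℚ + m) - 1ℚ)) * c)
                     + (- (0ℚ * ((1ℚ + m) - 0ℚ)) * c - - (m * ((1ℚ + m) - m)) * c)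
                     ≡ ((1ℚ + m) + (1ℚ + m)) * c - (c + c)
    expand = solve-∀ ℚ-ring
  ΔS (suc k) 1+k<N = begin
    Δ S (suc k)                                        ≡⟨ Δ-suc S S-periodic 1+k<N ⟩
    (S (suc k) - S (suc (suc k))) + (S (suc k) - S k)  ≡⟨ cong₂ (λ a b → (parabola n a - parabola n b) + (parabola n a - parabola n K))
                                                                (ℕtoℚ-suc k) (trans (ℕtoℚ-suc (suc k)) (cong (1ℚ +_) (ℕtoℚ-suc k))) ⟩
    (parabola n (1ℚ + K) - parabola n (1ℚ + (1ℚ + K))) + (parabola n (1ℚ + K) - parabola n K)
                                                       ≡⟨ second-difference n K c ⟩
    0ℚ - (c + c)                                       ∎
    where
    open ≡-Reasoning
    n K : ℚ
    n = ℕtoℚ N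
    K = ℕtoℚ k
    second-difference : ∀ n K c → (- ((1ℚ + K) * (n - (1ℚ + K))) * c - - ((1ℚ + (1ℚ + K)) * (n - (1ℚ + (1ℚ + K)))) * c)
                                  + (- ((1ℚ + K) * (n - (1ℚ + K))) * c - - (K * (n - K)) * c) ≡ 0ℚ - (c + c)
    second-difference = solve-∀ ℚ-ring

  -- W solves x (k + 2) + x k = 4 x (k + 1), hence so does k ↦ W k + W (N ∸ k) for 0 < k < N;
  -- at k = 0 its defect is 2 (U N - 1), which the factor ½ * _ * e normalises to 1.
  D : ℕ → ℚ
  D k = ½ * (ℕtoℚ (W k) + ℕtoℚ (W (N ∸ k))) * e

  D-periodic : D N ≡ D 0
  D-periodic = trans (cong (λ t → ½ * (ℕtoℚ (W N) + ℕtoℚ (W t)) * e) (ℕₚ.n∸n≡0 N))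
                     (cong (λ t → ½ * t * e) (ℚₚ.+-comm (ℕtoℚ (W N)) 0ℚ))

  W-recurrenceℚ : ∀ k → ℕtoℚ (W (2 ℕ.+ k)) + ℕtoℚ (W k) ≡ ℕtoℚ 4 * ℕtoℚ (W (1 ℕ.+ k))
  W-recurrenceℚ k = trans (sym (ℕtoℚ-+ (W (2 ℕ.+ k)) (W k))) (trans (cong ℕtoℚ (W-recurrence k)) (ℕtoℚ-* 4 (W (1 ℕ.+ k))))

  ΔD-zero : Δ D 0 + (D 0 + D 0) ≡ 1ℚ
  ΔD-zero = begin
    Δ D 0 + (D 0 + D 0)
      ≡⟨ cong (_+ (D 0 + D 0)) (Δ-zero D D-periodic) ⟩
    ((D 0 - D 1) + (D 0 - D n′)) + (D 0 + D 0)
      ≡⟨ cong (λ t → ((D 0 - D 1) + (D 0 - ½ * (a + ℕtoℚ (W t)) * e)) + (D 0 + D 0)) N∸n′≡1 ⟩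
    ((d₀ - ½ * (1ℚ + a) * e) + (d₀ - ½ * (a + 1ℚ) * e)) + (d₀ + d₀)
      ≡⟨ collect w a e ⟩
    ½ * (ℕtoℚ 4 * w - (ℕtoℚ 2 * a + ℕtoℚ 2)) * e
      ≡⟨ cong (λ t → ½ * (t - (ℕtoℚ 2 * a + ℕtoℚ 2)) * e) boundary ⟩
    ½ * ((ℕtoℚ 2 * a + ℕtoℚ 2 * u) - (ℕtoℚ 2 * a + ℕtoℚ 2)) * e
      ≡⟨ simplify a u e ⟩
    (u - 1ℚ) * e
      ≡⟨ [U-1]e≡1 ⟩
    1ℚ ∎
    where
    open ≡-Reasoning
    u w a d₀ : ℚ
    u = ℕtoℚ (U N)
    w = ℕtoℚ (W N)
    a = ℕtoℚ (W n′)
    d₀ = ½ * (0ℚ + w) * e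
    N∸n′≡1 : N ∸ n′ ≡ 1
    N∸n′≡1 = trans (ℕₚ.+-∸-assoc 1 (ℕₚ.≤-refl {n′})) (cong suc (ℕₚ.n∸n≡0 n′))
    boundary : ℕtoℚ 4 * w ≡ ℕtoℚ 2 * a + ℕtoℚ 2 * u
    boundary = trans (sym (ℕtoℚ-* 4 (W N))) (trans (cong ℕtoℚ (W-boundary n′))
      (trans (ℕtoℚ-+ (2 ℕ.* W n′) (2 ℕ.* U N)) (cong₂ _+_ (ℕtoℚ-* 2 (W n′)) (ℕtoℚ-* 2 (U N)))))
    collect : ∀ w a e → ((½ * (0ℚ + w) * e - ½ * (1ℚ + a) * e) + (½ * (0ℚ + w) * e - ½ * (a + 1ℚ) * e))
                        + (½ * (0ℚ + w) * e + ½ * (0ℚ + w) * e)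
                        ≡ ½ * (ℕtoℚ 4 * w - (ℕtoℚ 2 * a + ℕtoℚ 2)) * e
    collect = solve-∀ ℚ-ring
    simplify : ∀ a u e → ½ * ((ℕtoℚ 2 * a + ℕtoℚ 2 * u) - (ℕtoℚ 2 * a + ℕtoℚ 2)) * e ≡ (u - 1ℚ) * e
    simplify = solve-∀ ℚ-ring
  ΔD-suc : ∀ {k} → suc k < N → Δ D (suc k) + (D (suc k) + D (suc k)) ≡ 0ℚ
  ΔD-suc {k} 1+k<N = begin
    Δ D (suc k) + (D (suc k) + D (suc k))
      ≡⟨ cong (_+ (D (suc k) + D (suc k))) (Δ-suc D D-periodic 1+k<N) ⟩
    ((D (suc k) - D (suc (suc k))) + (D (suc k) - D k)) + (D (suc k) + D (suc k))
      ≡⟨ cong₂ (λ t t′ → ((Dk t - ½ * (ℕtoℚ (W (suc (suc k))) + ℕtoℚ (W b)) * e) + (Dk t - ½ * (ℕtoℚ (W k) + ℕtoℚ (W t′)) * e)) + (Dk t + Dk t))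
               N∸[1+k]≡1+b N∸k≡2+b ⟩
    ((Dk (suc b) - ½ * (ℕtoℚ (W (2 ℕ.+ k)) + ℕtoℚ (W b)) * e) + (Dk (suc b) - ½ * (ℕtoℚ (W k) + ℕtoℚ (W (2 ℕ.+ b))) * e))
      + (Dk (suc b) + Dk (suc b))
      ≡⟨ collect (ℕtoℚ (W (1 ℕ.+ k))) (ℕtoℚ (W (2 ℕ.+ k))) (ℕtoℚ (W k)) (ℕtoℚ (W (1 ℕ.+ b))) (ℕtoℚ (W (2 ℕ.+ b))) (ℕtoℚ (W b)) e ⟩
    ½ * ((ℕtoℚ 4 * ℕtoℚ (W (1 ℕ.+ k)) - (ℕtoℚ (W (2 ℕ.+ k)) + ℕtoℚ (W k)))
         + (ℕtoℚ 4 * ℕtoℚ (W (1 ℕ.+ b)) - (ℕtoℚ (W (2 ℕ.+ b)) + ℕtoℚ (W b)))) * e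
      ≡⟨ cong₂ (λ x y → ½ * ((ℕtoℚ 4 * ℕtoℚ (W (1 ℕ.+ k)) - x) + (ℕtoℚ 4 * ℕtoℚ (W (1 ℕ.+ b)) - y)) * e)
               (W-recurrenceℚ k) (W-recurrenceℚ b) ⟩
    ½ * ((ℕtoℚ 4 * ℕtoℚ (W (1 ℕ.+ k)) - ℕtoℚ 4 * ℕtoℚ (W (1 ℕ.+ k)))
         + (ℕtoℚ 4 * ℕtoℚ (W (1 ℕ.+ b)) - ℕtoℚ 4 * ℕtoℚ (W (1 ℕ.+ b)))) * e
      ≡⟨ cancel (ℕtoℚ 4 * ℕtoℚ (W (1 ℕ.+ k))) (ℕtoℚ 4 * ℕtoℚ (W (1 ℕ.+ b))) e ⟩
    0ℚ ∎
    where
    open ≡-Reasoning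
    b : ℕ
    b = N ∸ suc (suc k)
    Dk : ℕ → ℚ
    Dk t = ½ * (ℕtoℚ (W (suc k)) + ℕtoℚ (W t)) * e
    N∸[1+k]≡1+b : N ∸ suc k ≡ suc b
    N∸[1+k]≡1+b = ℕₚ.+-∸-assoc 1 1+k<N
    N∸k≡2+b : N ∸ k ≡ suc (suc b)
    N∸k≡2+b = trans (ℕₚ.+-∸-assoc 1 (ℕₚ.<⇒≤ 1+k<N)) (cong suc N∸[1+k]≡1+b)
    collect : ∀ x₁ x₂ x₀ y₁ y₂ y₀ e →
      ((½ * (x₁ + y₁) * e - ½ * (x₂ + y₀) * e) + (½ * (x₁ + y₁) * e - ½ * (x₀ + y₂) * e)) + (½ * (x₁ + y₁) * e + ½ * (x₁ + y₁) * e)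
      ≡ ½ * ((ℕtoℚ 4 * x₁ - (x₂ + x₀)) + (ℕtoℚ 4 * y₁ - (y₂ + y₀))) * e
    collect = solve-∀ ℚ-ring
    cancel : ∀ x y e → ½ * ((x - x) + (y - y)) * e ≡ 0ℚ
    cancel = solve-∀ ℚ-ring

  ΔD : ∀ k → k < N → Δ D k + (D k + D k) ≡ impulse false k
  ΔD zero    _     = ΔD-zero
  ΔD (suc k) 1+k<N = ΔD-suc 1+k<N

  G : Bool → ℕ → ℚ
  G false k = ½ * (S k + D k)
  G true  k = ½ * (S k - D k)

  ΔG : ∀ b k → k < N → Δ (G b) k + (G b k - G (not b) k) ≡ impulse b k - c
  ΔG false k k<N = begin
    Δ (G false) k + (G false k - G true k)
      ≡⟨ split (S k) (S (suc k % N)) (S ((k ℕ.+ n′) % N)) (D k) (D (suc k % N)) (D ((k ℕ.+ n′) % N)) ⟩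
    ½ * Δ S k + ½ * (Δ D k + (D k + D k))
      ≡⟨ cong₂ (λ x y → ½ * x + ½ * y) (ΔS k k<N) (ΔD k k<N) ⟩
    ½ * (impulse false k - (c + c)) + ½ * impulse false k
      ≡⟨ combine (impulse false k) c ⟩
    impulse false k - c ∎
    where
    open ≡-Reasoning
    split : ∀ s s⁺ s⁻ d d⁺ d⁻ →
      ((½ * (s + d) - ½ * (s⁺ + d⁺)) + (½ * (s + d) - ½ * (s⁻ + d⁻))) + (½ * (s + d) - ½ * (s - d))
      ≡ ½ * ((s - s⁺) + (s - s⁻)) + ½ * (((d - d⁺) + (d - d⁻)) + (d + d))
    split = solve-∀ ℚ-ring
    combine : ∀ i c → ½ * (i - (c + c)) + ½ * i ≡ i - c
    combine = solve-∀ ℚ-ring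
  ΔG true k k<N = begin
    Δ (G true) k + (G true k - G false k)
      ≡⟨ split (S k) (S (suc k % N)) (S ((k ℕ.+ n′) % N)) (D k) (D (suc k % N)) (D ((k ℕ.+ n′) % N)) ⟩
    ½ * Δ S k - ½ * (Δ D k + (D k + D k))
      ≡⟨ cong₂ (λ x y → ½ * x - ½ * y) (ΔS k k<N) (ΔD k k<N) ⟩
    ½ * (impulse false k - (c + c)) - ½ * impulse false k
      ≡⟨ combine (impulse false k) c ⟩
    0ℚ - c ∎
    where
    open ≡-Reasoning
    split : ∀ s s⁺ s⁻ d d⁺ d⁻ →
      ((½ * (s - d) - ½ * (s⁺ - d⁺)) + (½ * (s - d) - ½ * (s⁻ - d⁻))) + (½ * (s - d) - ½ * (s + d))
      ≡ ½ * ((s - s⁺) + (s - s⁻)) - ½ * (((d - d⁺) + (d - d⁻)) + (d + d))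
    split = solve-∀ ℚ-ring
    combine : ∀ i c → ½ * (i - (c + c)) - ½ * i ≡ 0ℚ - c
    combine = solve-∀ ℚ-ring

  -- By translation invariance the Green's function only depends on the cyclic offset and on
  -- whether the two vertices lie on the same cycle.
  green : Vertex N → Vertex N → ℚ
  green (t , i) (s , j) = G (s xor t) (offset j i)

  δ-same-layer : ∀ s j i → δ (s , j) (s , i) ≡ impulse false (offset j i)
  δ-same-layer s j i with offset j i in eq
  ... | zero  = trans (cong (λ i′ → δ (s , j) (s , i′)) (sym (offset≡0⇒≡ eq))) (δ-self (s , j))
  ... | suc _ = δ-distinct {u = s , j} {s , i}
                  (λ sj≡si → ℕₚ.1+n≢0 (trans (sym eq) (trans (cong (λ j′ → offset j′ i) (cong proj₂ sj≡si)) (offset-self i))))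

  δ≡impulse : ∀ s j t i → δ (s , j) (t , i) ≡ impulse (s xor t) (offset j i)
  δ≡impulse false j false i = δ-same-layer false j i
  δ≡impulse true  j true  i = δ-same-layer true j i
  δ≡impulse false j true  i = δ-distinct {u = false , j} {true , i} λ ()
  δ≡impulse true  j false i = δ-distinct {u = true , j} {false , i} λ ()

  outflow-green : ∀ a v → outflow N (green a) v ≡ δ v a - c
  outflow-green (t , i) (s , j) = begin
    outflow N (green (t , i)) (s , j)
      ≡⟨ outflow-local (green (t , i)) s j ⟩
    (G b k - G b (offset (next N j) i)) + (G b k - G b (offset (prev j) i)) + (G b k - G ((not s) xor t) k)
      ≡⟨ cong₂ (λ k⁺ k⁻ → (G b k - G b k⁺) + (G b k - G b k⁻) + (G b k - G ((not s) xor t) k))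
               (offset-next j i) (offset-prev j i) ⟩
    Δ (G b) k + (G b k - G ((not s) xor t) k)
      ≡⟨ cong (λ b′ → Δ (G b) k + (G b k - G b′ k)) (not-distribˡ-xor s t) ⟨
    Δ (G b) k + (G b k - G (not b) k)
      ≡⟨ ΔG b k (offset<N j i) ⟩
    impulse b k - c
      ≡⟨ cong (_- c) (δ≡impulse s j t i) ⟨
    δ (s , j) (t , i) - c ∎
    where
    open ≡-Reasoning
    b : Bool
    b = s xor t
    k : ℕ
    k = offset j i

  potential : Vertex N → Vertex N → Vertex N → ℚ
  potential a b v = green a v - green b v

  outflow-potential : ∀ a b v → outflow N (potential a b) v ≡ δ v a - δ v b
  outflow-potential a b (s , j) = begin
    outflow N (potential a b) (s , j)
      ≡⟨ outflow-local (potential a b) s j ⟩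
    ((ga₀ - gb₀) - (ga₁ - gb₁)) + ((ga₀ - gb₀) - (ga₂ - gb₂)) + ((ga₀ - gb₀) - (ga₃ - gb₃))
      ≡⟨ regroup ga₀ ga₁ ga₂ ga₃ gb₀ gb₁ gb₂ gb₃ ⟩
    ((ga₀ - ga₁) + (ga₀ - ga₂) + (ga₀ - ga₃)) - ((gb₀ - gb₁) + (gb₀ - gb₂) + (gb₀ - gb₃))
      ≡⟨ cong₂ _-_ (outflow-local (green a) s j) (outflow-local (green b) s j) ⟨
    outflow N (green a) (s , j) - outflow N (green b) (s , j)
      ≡⟨ cong₂ _-_ (outflow-green a (s , j)) (outflow-green b (s , j)) ⟩
    (δ (s , j) a - c) - (δ (s , j) b - c)
      ≡⟨ cancel (δ (s , j) a) (δ (s , j) b) c ⟩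
    δ (s , j) a - δ (s , j) b ∎
    where
    open ≡-Reasoning
    ga₀ ga₁ ga₂ ga₃ gb₀ gb₁ gb₂ gb₃ : ℚ
    ga₀ = green a (s , j)
    ga₁ = green a (s , next N j)
    ga₂ = green a (s , prev j)
    ga₃ = green a (not s , j)
    gb₀ = green b (s , j)
    gb₁ = green b (s , next N j)
    gb₂ = green b (s , prev j)
    gb₃ = green b (not s , j)
    regroup : ∀ a₀ a₁ a₂ a₃ b₀ b₁ b₂ b₃ →
      ((a₀ - b₀) - (a₁ - b₁)) + ((a₀ - b₀) - (a₂ - b₂)) + ((a₀ - b₀) - (a₃ - b₃))
      ≡ ((a₀ - a₁) + (a₀ - a₂) + (a₀ - a₃)) - ((b₀ - b₁) + (b₀ - b₂) + (b₀ - b₃))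
    regroup = solve-∀ ℚ-ring
    cancel : ∀ x y c → (x - c) - (y - c) ≡ x - y
    cancel = solve-∀ ℚ-ring

  R₀ : Vertex N → Vertex N → ℚ
  R₀ a b = potential a b a - potential a b b

  R₀-isEffRes : ∀ a b → IsEffRes N a b (R₀ a b)
  R₀-isEffRes a b = potential a b , outflow-potential a b , refl

  effRes≡R₀ : ∀ {a b r} → IsEffRes N a b r → r ≡ R₀ a b
  effRes≡R₀ {a} {b} r-isEffRes = effRes-unique N r-isEffRes (potential a b) (outflow-potential a b)

  green-diagonal : ∀ a → green a a ≡ G false 0
  green-diagonal (t , i) = cong₂ G (xor-same t) (offset-self i)

  green-row : ∀ a → sumList (map (green a) (allVertices N)) ≡ sumRange N S
  green-row (t , i) = begin
    sumList (map (green (t , i)) (allVertices N))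
      ≡⟨ sumList-allVertices (green (t , i)) ⟩
    sumFin (λ j → G (false xor t) (offset j i)) + sumFin (λ j → G (true xor t) (offset j i))
      ≡⟨ cong₂ _+_ (sumFin-offset (G (false xor t)) i) (sumFin-offset (G (true xor t)) i) ⟩
    sumRange N (G (false xor t)) + sumRange N (G (true xor t))
      ≡⟨ both-layers t ⟩
    sumRange N (G false) + sumRange N (G true)
      ≡⟨ sumRange-+ N (G false) (G true) ⟨
    sumRange N (λ k → G false k + G true k)
      ≡⟨ sumRange-cong N (λ k _ → halves (S k) (D k)) ⟩
    sumRange N S ∎
    where
    open ≡-Reasoning
    both-layers : ∀ t → sumRange N (G (false xor t)) + sumRange N (G (true xor t)) ≡ sumRange N (G false) + sumRange N (G true)
    both-layers false = refl
    both-layers true  = ℚₚ.+-comm (sumRange N (G true)) (sumRange N (G false))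
    halves : ∀ s d → ½ * (s + d) + ½ * (s - d) ≡ s
    halves = solve-∀ ℚ-ring

  parabolaSum : ℚ → ℚ
  parabolaSum x = - (ℕtoℚ N * x * (x - 1ℚ) * ½ - (x - 1ℚ) * x * (ℕtoℚ 2 * x - 1ℚ) * inv (ℕtoℚ 6)) * c

  sumRange-S : sumRange N S ≡ parabolaSum (ℕtoℚ N) - parabolaSum 0ℚ
  sumRange-S = sumRange-telescope N S (parabolaSum ∘ ℕtoℚ)
    (λ k → trans (difference (ℕtoℚ N) (ℕtoℚ k) c) (cong (λ x → parabolaSum x - parabolaSum (ℕtoℚ k)) (sym (ℕtoℚ-suc k))))
    where
    difference : ∀ n x c →
      let F = λ x → - (n * x * (x - 1ℚ) * ½ - (x - 1ℚ) * x * (ℕtoℚ 2 * x - 1ℚ) * inv (ℕtoℚ 6)) * c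
      in - (x * (n - x)) * c ≡ F (1ℚ + x) - F x
    difference = solve-∀ ℚ-ring

  kirchhoff-R₀ : kirchhoff N R₀ ≡ kirchhoffClosedForm N
  kirchhoff-R₀ = begin
    kirchhoff N R₀
      ≡⟨ cong (½ *_) (sumList-kirchhoff (allVertices N) green (G false 0) (sumRange N S) green-diagonal green-row) ⟩
    ½ * (m * (m * (g₀ + g₀)) - (m * T + m * T))
      ≡⟨ cong₂ (λ m T → ½ * (m * (m * (g₀ + g₀)) - (m * T + m * T))) |V|≡N+N sumRange-S ⟩
    ½ * ((n + n) * ((n + n) * (g₀ + g₀)) - ((n + n) * F + (n + n) * F))
      ≡⟨ expand n w e c ⟩
    n * n * (w * e) + (n + n) * c * (n * (n * n - 1ℚ) * inv (ℕtoℚ 6))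
      ≡⟨ cong (λ t → n * n * (w * e) + t * (n * (n * n - 1ℚ) * inv (ℕtoℚ 6))) [N+N]c≡1 ⟩
    n * n * (w * e) + 1ℚ * (n * (n * n - 1ℚ) * inv (ℕtoℚ 6))
      ≡⟨ reorder (n * n * (w * e)) (n * (n * n - 1ℚ) * inv (ℕtoℚ 6)) ⟩
    kirchhoffClosedForm N ∎
    where
    open ≡-Reasoning
    m n w g₀ T F : ℚ
    m = ℕtoℚ (length (allVertices N))
    n = ℕtoℚ N
    w = ℕtoℚ (W N)
    g₀ = G false 0
    T = sumRange N S
    F = parabolaSum n - parabolaSum 0ℚ
    |V|≡N+N : m ≡ n + n
    |V|≡N+N = trans (cong ℕtoℚ (length-allVertices N)) (ℕtoℚ-+ N N)
    expand : ∀ n w e c →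
      let g₀ = ½ * (- (0ℚ * (n - 0ℚ)) * c + ½ * (0ℚ + w) * e)
          P  = λ x → - (n * x * (x - 1ℚ) * ½ - (x - 1ℚ) * x * (ℕtoℚ 2 * x - 1ℚ) * inv (ℕtoℚ 6)) * c
          F  = P n - P 0ℚ
      in ½ * ((n + n) * ((n + n) * (g₀ + g₀)) - ((n + n) * F + (n + n) * F))
         ≡ n * n * (w * e) + (n + n) * c * (n * (n * n - 1ℚ) * inv (ℕtoℚ 6))
    expand = solve-∀ ℚ-ring
    reorder : ∀ x y → x + 1ℚ * y ≡ y + x
    reorder = solve-∀ ℚ-ring

theorem3p1 : (n : ℕ) .{{_ : NonZero n}} →
    Σ (Vertex n → Vertex n → ℚ) (λ R → (∀ a b → IsEffRes n a b (R a b)))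
    × ((R : Vertex n → Vertex n → ℚ) → (∀ a b → IsEffRes n a b (R a b)) →
    embed (kirchhoff n R) ≡ rhs n)
theorem3p1 (suc n′) = (R₀ , R₀-isEffRes) , λ R R-isEffRes → begin
  embed (kirchhoff N R)                   ≡⟨ cong embed (kirchhoff-cong N (λ a b → effRes≡R₀ (R-isEffRes a b))) ⟩
  embed (kirchhoff N R₀)                  ≡⟨ cong embed kirchhoff-R₀ ⟩
  embed (kirchhoffClosedForm N)           ≡⟨ rhs≡kirchhoffClosedForm n′ ⟨
  rhs N                                   ∎
  where
  open Prism n′
  open ≡-Reasoning
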